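{- Let $a,b\ge 2$ be integers. Then the Ehrhart polynomial of the matroid basis polytope $P_{S(a,b)}$ is $$L_{P_{S(a,b)}}(t)=1+\frac{1}{(a-1)!\,(b-1)!} \sum_{i=1}^{a+b-1} \left(\sum_{j=i-1}^{a+b-2} (-1)^{j-i+1}\, \frac{B_{j-i+1}\,\sigma_{a+b-2-j}}{j+1} \binom{j+1}{i}\right) t^i,$$ where $\sigma_\ell$ is the $\ell$-th elementary symmetric function evaluated on the $a+b-2$ numbers $1,2,\ldots,a-1,1,2,\ldots,b-1$ (with $\sigma_0=1$), and $B_s$ is the $s$-th Bernoulli number.
   Context: For lattice paths $U,L$ from $(0,0)$ to $(m,r)$ using unit steps $(1,0),(0,1)$ with $L$ never above $U$, the lattice path matroid $M[U,L]$ is the matroid on $\{1,\dots,r+m\}$ whose bases are the sets of indices of the $(0,1)$-steps of lattice paths from $(0,0)$ to $(m,r)$ never above $U$ and never below $L$. The snake $S(a,b)$ is the lattice path matroid whose region between $U$ and $L$ is the strip of unit squares consisting of a horizontal row of $a$ unit squares starting with $[0,1]\times[0,1]$, followed by a vertical column of $b$ unit squares whose bottom square is the last square of that row (so $a+b-1$ squares in total). The matroid basis polytope is $P_M=\mathrm{conv}\{\sum_{i\in B}e_i: B\text{ a basis}\}$, and for a lattice polytope $P\subseteq\mathbb{R}^n$, $L_P(t)=\#(tP\cap\mathbb{Z}^n)$ for integers $t\ge0$ is its Ehrhart polynomial. Bernoulli numbers use the standard convention $B_0=1$, $B_1=-\tfrac12$, $B_2=\tfrac16,\dots$. -}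

module Defs where

open import Data.Nat as ℕ using (ℕ; zero; suc; _∸_; _!)
open import Data.Nat.Properties using (_!*_!≢0)
open import Data.Nat.Combinatorics using (_C_)
open import Data.Integer as ℤ using (ℤ; +_)
open import Data.Rational as ℚ using (ℚ; 0ℚ; 1ℚ; _+_; _*_; -_; _≤_)
open import Data.Bool using (Bool; true; false; if_then_else_)
open import Data.List as List using (List; []; _∷_; _++_; upTo; map; foldr; length; replicate; zipWith; lookup)
open import Data.List.Relation.Unary.All using (All)
open import Data.List.Relation.Unary.Unique.Propositional using (Unique)
open import Data.List.Membership.Propositional using (_∈_)
open import Data.Product using (Σ; _×_; _,_; proj₁; proj₂)
open import Relation.Binary.PropositionalEquality using (_≡_)

sum : List ℚ → ℚ
sum = foldr _+_ 0ℚ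

ℕ→ℚ : ℕ → ℚ
ℕ→ℚ n = (+ n) ℚ./ 1

ℤ→ℚ : ℤ → ℚ
ℤ→ℚ z = z ℚ./ 1

1/suc : ℕ → ℚ
1/suc n = (+ 1) ℚ./ suc n

-- [lo, lo+1, …, hi]  (empty if hi < lo)
range : ℕ → ℕ → List ℕ
range lo hi = map (lo ℕ.+_) (upTo (suc hi ∸ lo))

Σ[_⋯_] : ℕ → ℕ → (ℕ → ℚ) → ℚ
Σ[ lo ⋯ hi ] f = sum (map f (range lo hi))

_^ℚ_ : ℚ → ℕ → ℚ
x ^ℚ zero = 1ℚ
x ^ℚ suc k = x * (x ^ℚ k)

-- Bernoulli numbers (B₀ = 1, B₁ = -1/2, B₂ = 1/6, …), defined by the
-- standard recurrence  Σ_{k=0}^{n} C(n+1,k) B_k = 0  for n ≥ 1,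
-- i.e.  B_n = - 1/(n+1) Σ_{k=0}^{n-1} C(n+1,k) B_k.

bernoulliUpTo : ℕ → List ℚ
bernoulliUpTo zero = 1ℚ ∷ []
bernoulliUpTo (suc n) = prev ++ (next ∷ [])
  where
  prev : List ℚ
  prev = bernoulliUpTo n
  idx : List (ℕ × ℚ)
  idx = List.zip (upTo (suc n)) prev
  next : ℚ
  next = - (1/suc (suc n) * sum (map (λ p → ℕ→ℚ (suc (suc n) C proj₁ p) * proj₂ p) idx))

bernoulli : ℕ → ℚ
bernoulli n = List.foldl (λ _ x → x) 0ℚ (bernoulliUpTo n)

esym : List ℚ → ℕ → ℚ
esym [] zero = 1ℚ
esym [] (suc ℓ) = 0ℚ
esym (x ∷ xs) zero = 1ℚ
esym (x ∷ xs) (suc ℓ) = esym xs (suc ℓ) + x * esym xs ℓ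

oneTo : ℕ → List ℚ
oneTo k = map (λ i → ℕ→ℚ (suc i)) (upTo k)

σ : (a b ℓ : ℕ) → ℚ
σ a b ℓ = esym (oneTo (a ∸ 1) ++ oneTo (b ∸ 1)) ℓ

-- A lattice path is a word of steps; true = north step (0,1),
-- false = east step (1,0).  Step number i (1-indexed in the paper)
-- is list position i-1 here.

north : List Bool → ℕ
north [] = 0
north (true ∷ v) = suc (north v)
north (false ∷ v) = north v

northPrefix : ℕ → List Bool → ℕ
northPrefix zero v = 0
northPrefix (suc k) [] = 0
northPrefix (suc k) (true ∷ v) = suc (northPrefix k v)
northPrefix (suc k) (false ∷ v) = northPrefix k v

IsPath : (m r : ℕ) → List Bool → Set
IsPath m r P = (length P ≡ m ℕ.+ r) × (north P ≡ r)

-- P never goes above Q (paths of the same length n): after every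
-- k ≤ n steps both lie on the antidiagonal x + y = k, and the height
-- of P is at most that of Q.
NeverAbove : List Bool → List Bool → Set
NeverAbove P Q = (k : ℕ) → k ℕ.≤ length P → northPrefix k P ℕ.≤ northPrefix k Q

-- Bases of M[U,L] on ground set {1,…,m+r}: a basis B is encoded by its
-- indicator word (true at position i-1 iff i ∈ B); it is the set of
-- north-step indices of a lattice path P from (0,0) to (m,r) never above
-- U and never below L, and the indicator word of B is exactly P.
IsBasis : (m r : ℕ) (U L : List Bool) → List Bool → Set
IsBasis m r U L B = IsPath m r B × NeverAbove B U × NeverAbove L B

-- The snake S(a,b) as M[U,L] with m = a, r = b and
--   U = N E^(a-1) N^(b-1) E,   L = E^a N^b.
-- For a, b ≥ 1 the region between U and L is the row of a unit squares
-- [0,1]×[0,1], …, [a-1,a]×[0,1] followed by the column of b squares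
-- [a-1,a]×[0,1], …, [a-1,a]×[b-1,b].
snakeU : ℕ → ℕ → List Bool
snakeU a b = true ∷ (replicate (a ∸ 1) false ++ (replicate (b ∸ 1) true ++ (false ∷ [])))

snakeL : ℕ → ℕ → List Bool
snakeL a b = replicate a false ++ replicate b true

IsSnakeBasis : ℕ → ℕ → List Bool → Set
IsSnakeBasis a b = IsBasis a b (snakeU a b) (snakeL a b)

scaledIndicator : ℚ → List Bool → List ℚ
scaledIndicator c B = map (λ b → if b then c else 0ℚ) B

combination : ℕ → List (ℚ × List Bool) → List ℚ
combination n [] = replicate n 0ℚ
combination n ((c , B) ∷ cs) = zipWith _+_ (scaledIndicator c B) (combination n cs)

-- x ∈ t·P_M where P_M = conv{e_B : B basis} ⊆ ℝ^n, for a matroid with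
-- bases given by the predicate IsB:  x = Σ μ_i e_{B_i} with μ_i ≥ 0,
-- Σ μ_i = t.  (Since t·conv(V) = {Σ μ_i v_i : μ_i ≥ 0, Σ μ_i = t}.)
InDilate : (n : ℕ) (IsB : List Bool → Set) (t : ℕ) → List ℚ → Set
InDilate n IsB t x =
  Σ (List (ℚ × List Bool)) λ cs →
    All (λ p → (0ℚ ≤ proj₁ p) × IsB (proj₂ p)) cs ×
    (sum (map proj₁ cs) ≡ ℕ→ℚ t) ×
    (combination n cs ≡ x)

LatticePointOf : (n : ℕ) (IsB : List Bool → Set) (t : ℕ) → List ℤ → Set
LatticePointOf n IsB t x = (length x ≡ n) × InDilate n IsB t (map ℤ→ℚ x)

HasCard : {A : Set} → (A → Set) → ℕ → Set
HasCard {A} P N =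
  Σ (List A) λ xs →
    (length xs ≡ N) × Unique xs × All P xs × ((x : A) → P x → x ∈ xs)

EhrhartValue : (n : ℕ) (IsB : List Bool → Set) (t N : ℕ) → Set
EhrhartValue n IsB t N = HasCard (LatticePointOf n IsB t) N

innerCoeff : (a b i : ℕ) → ℚ
innerCoeff a b i =
  Σ[ i ∸ 1 ⋯ a ℕ.+ b ∸ 2 ] λ j →
    let s = suc j ∸ i in
    ((- 1ℚ) ^ℚ s) * (bernoulli s * σ a b (a ℕ.+ b ∸ 2 ∸ j))
      * 1/suc j * ℕ→ℚ (suc j C i)

snakeEhrhartFormula : (a b t : ℕ) → ℚ
snakeEhrhartFormula a b t =
  1ℚ + ((+ 1) ℚ./ ((a ∸ 1) ! ℕ.* (b ∸ 1) !)) {{(a ∸ 1) !* (b ∸ 1) !≢0}}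
       * (Σ[ 1 ⋯ a ℕ.+ b ∸ 1 ] λ i → innerCoeff a b i * (ℕ→ℚ t ^ℚ i))

-- Write a = a'+1, b = b'+1.  We count the lattice points of t·P_{S(a,b)}
-- explicitly, obtaining  L(t) = ∑_{s=0}^{t} C(s+a',a')·C(s+b',b'),  and show
-- that the paper's polynomial has the same value.
--
-- Finite sums, binomial identities
-- and the Bernoulli recurrence give Faulhaber's formula
-- (j+1) ∑_{k=1}^{t} k^j = ∑_i (-1)^{j-i} C(j+1,i+1) B_{j-i} t^{i+1}.
-- Since C(k+a',a') a'! = ∏_{i ≤ a'} (k+i) and ∏ (k+x) = ∑_j e_{n-j}(x) k^j,
-- exchanging sums turns the paper's formula into ∑_{s ≤ t} C(s+a',a') C(s+b',b').
--
-- A word is a basis of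
-- S(a,b) iff it is a path to (a,b) with at most one north step among its
-- first a steps.  Hence every point of t·P has coordinates in [0,t],
-- coordinate sum b·t and first-a coordinate sum ≤ t, so a lattice point is
-- u ++ (t - v) for weak compositions u ∈ ℕ^a, v ∈ ℕ^b of a common s ≤ t;
-- conversely each such pair is realised by the lower path plus "hook"
-- bases.
module Submission where

module Casts where
  open import Defs
  open import Data.Nat as ℕ using (suc)
  import Data.Nat.Coprimality as Coprimality
  open import Data.Integer as ℤ using (ℤ; +_)
  import Data.Integer.Properties as ℤP
  open import Data.Rational as ℚ using (ℚ; mkℚ; 1ℚ; _+_; _*_; _≤_; *≤*)
  import Data.Rational.Properties as ℚP
  open import Data.Rational.Unnormalised using (*≡*)
  import Data.Rational.Unnormalised.Properties as ℚᵘP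
  open import Relation.Binary.PropositionalEquality

  -- z / 1 is already in normal form.
  normal : ℤ → ℚ
  normal z = mkℚ z 0 (Coprimality.sym (Coprimality.1-coprimeTo ℤ.∣ z ∣))

  ℤ→ℚ≡normal : ∀ z → ℤ→ℚ z ≡ normal z
  ℤ→ℚ≡normal z = ℚP.↥p/↧p≡p (normal z)

  ℤ→ℚ-+ : ∀ x y → ℤ→ℚ (x ℤ.+ y) ≡ ℤ→ℚ x + ℤ→ℚ y
  ℤ→ℚ-+ x y rewrite ℤ→ℚ≡normal (x ℤ.+ y) | ℤ→ℚ≡normal x | ℤ→ℚ≡normal y =
    ℚP.toℚᵘ-injective (ℚᵘP.≃-sym (ℚᵘP.≃-trans (ℚP.toℚᵘ-homo-+ (normal x) (normal y))
      (*≡* (cong (ℤ._* + 1) (cong₂ ℤ._+_ (ℤP.*-identityʳ x) (ℤP.*-identityʳ y))))))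

  ℤ→ℚ-* : ∀ x y → ℤ→ℚ (x ℤ.* y) ≡ ℤ→ℚ x * ℤ→ℚ y
  ℤ→ℚ-* x y rewrite ℤ→ℚ≡normal (x ℤ.* y) | ℤ→ℚ≡normal x | ℤ→ℚ≡normal y =
    ℚP.toℚᵘ-injective (ℚᵘP.≃-sym (ℚP.toℚᵘ-homo-* (normal x) (normal y)))

  ℤ→ℚ-mono-≤ : ∀ {x y} → x ℤ.≤ y → ℤ→ℚ x ≤ ℤ→ℚ y
  ℤ→ℚ-mono-≤ {x} {y} x≤y rewrite ℤ→ℚ≡normal x | ℤ→ℚ≡normal y =
    *≤* (subst₂ ℤ._≤_ (sym (ℤP.*-identityʳ x)) (sym (ℤP.*-identityʳ y)) x≤y)

  ℤ→ℚ-cancel-≤ : ∀ {x y} → ℤ→ℚ x ≤ ℤ→ℚ y → x ℤ.≤ y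
  ℤ→ℚ-cancel-≤ {x} {y} p rewrite ℤ→ℚ≡normal x | ℤ→ℚ≡normal y with p
  ... | *≤* q = subst₂ ℤ._≤_ (ℤP.*-identityʳ x) (ℤP.*-identityʳ y) q

  ℤ→ℚ-injective : ∀ {x y} → ℤ→ℚ x ≡ ℤ→ℚ y → x ≡ y
  ℤ→ℚ-injective p =
    ℤP.≤-antisym (ℤ→ℚ-cancel-≤ (ℚP.≤-reflexive p)) (ℤ→ℚ-cancel-≤ (ℚP.≤-reflexive (sym p)))

  ℕ→ℚ-+ : ∀ m n → ℕ→ℚ (m ℕ.+ n) ≡ ℕ→ℚ m + ℕ→ℚ n
  ℕ→ℚ-+ m n = trans (cong ℤ→ℚ (ℤP.pos-+ m n)) (ℤ→ℚ-+ (+ m) (+ n))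

  ℕ→ℚ-* : ∀ m n → ℕ→ℚ (m ℕ.* n) ≡ ℕ→ℚ m * ℕ→ℚ n
  ℕ→ℚ-* m n = trans (cong ℤ→ℚ (ℤP.pos-* m n)) (ℤ→ℚ-* (+ m) (+ n))

  ℕ→ℚ-suc : ∀ n → ℕ→ℚ (suc n) ≡ 1ℚ + ℕ→ℚ n
  ℕ→ℚ-suc n = ℕ→ℚ-+ 1 n

  ℕ→ℚ-mono-≤ : ∀ {m n} → m ℕ.≤ n → ℕ→ℚ m ≤ ℕ→ℚ n
  ℕ→ℚ-mono-≤ p = ℤ→ℚ-mono-≤ (ℤ.+≤+ p)

  ℕ→ℚ-injective : ∀ {m n} → ℕ→ℚ m ≡ ℕ→ℚ n → m ≡ n
  ℕ→ℚ-injective p = ℤP.+-injective (ℤ→ℚ-injective p)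

  1/suc-inverse : ∀ n → 1/suc n * ℕ→ℚ (suc n) ≡ 1ℚ
  1/suc-inverse n =
    trans (cong₂ _*_ (ℚP.↥p/↧p≡p (ℚ.1/ normal (+ suc n))) (ℤ→ℚ≡normal (+ suc n)))
          (ℚP.*-inverseˡ (normal (+ suc n)))

  1/-inverse : ∀ d .{{_ : ℕ.NonZero d}} → ((+ 1) ℚ./ d) * ℕ→ℚ d ≡ 1ℚ
  1/-inverse (suc d) = 1/suc-inverse d

module FiniteSums where
  open import Defs
  open import Data.Nat as ℕ using (ℕ; zero; suc; _∸_; _<_; z<s; s<s)
  import Data.Nat.Properties as ℕP
  open import Data.Rational as ℚ using (ℚ; 0ℚ; _+_; _*_)
  import Data.Rational.Properties as ℚP
  open import Data.List using (map; applyUpTo; upTo)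
  import Data.List.Properties as LP
  open import Relation.Binary.PropositionalEquality
  open import Relation.Nullary using (¬_)
  open import Function using (_∘_)
  open import Data.Rational.Solver using (module +-*-Solver)
  open +-*-Solver

  ∑ : ℕ → (ℕ → ℚ) → ℚ
  ∑ zero f = 0ℚ
  ∑ (suc n) f = f 0 + ∑ n (λ k → f (suc k))

  ∑-cong-< : ∀ n {f g : ℕ → ℚ} → (∀ k → k < n → f k ≡ g k) → ∑ n f ≡ ∑ n g
  ∑-cong-< zero e = refl
  ∑-cong-< (suc n) e = cong₂ _+_ (e 0 z<s) (∑-cong-< n (λ k k<n → e (suc k) (s<s k<n)))

  ∑-cong : ∀ n {f g : ℕ → ℚ} → (∀ k → f k ≡ g k) → ∑ n f ≡ ∑ n g
  ∑-cong n e = ∑-cong-< n (λ k _ → e k)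

  ∑-zero : ∀ n {f : ℕ → ℚ} → (∀ k → k < n → f k ≡ 0ℚ) → ∑ n f ≡ 0ℚ
  ∑-zero zero e = refl
  ∑-zero (suc n) e =
    trans (cong₂ _+_ (e 0 z<s) (∑-zero n (λ k k<n → e (suc k) (s<s k<n)))) (ℚP.+-identityʳ 0ℚ)

  ∑-+ : ∀ n (f g : ℕ → ℚ) → ∑ n (λ k → f k + g k) ≡ ∑ n f + ∑ n g
  ∑-+ zero f g = refl
  ∑-+ (suc n) f g = trans (cong (f 0 + g 0 +_) (∑-+ n _ _))
    (solve 4 (λ a b c d → (a :+ b) :+ (c :+ d) := (a :+ c) :+ (b :+ d)) refl
       (f 0) (g 0) (∑ n (λ k → f (suc k))) (∑ n (λ k → g (suc k))))

  ∑-*ˡ : ∀ n c (f : ℕ → ℚ) → c * ∑ n f ≡ ∑ n (λ k → c * f k)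
  ∑-*ˡ zero c f = ℚP.*-zeroʳ c
  ∑-*ˡ (suc n) c f = trans (ℚP.*-distribˡ-+ c (f 0) _) (cong (c * f 0 +_) (∑-*ˡ n c _))

  ∑-*ʳ : ∀ n c (f : ℕ → ℚ) → ∑ n f * c ≡ ∑ n (λ k → f k * c)
  ∑-*ʳ n c f = trans (ℚP.*-comm _ c) (trans (∑-*ˡ n c f) (∑-cong n (λ k → ℚP.*-comm c (f k))))

  ∑-snoc : ∀ n (f : ℕ → ℚ) → ∑ (suc n) f ≡ ∑ n f + f n
  ∑-snoc zero f = trans (ℚP.+-identityʳ (f 0)) (sym (ℚP.+-identityˡ (f 0)))
  ∑-snoc (suc n) f =
    trans (cong (f 0 +_) (∑-snoc n (λ k → f (suc k)))) (sym (ℚP.+-assoc (f 0) _ _))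

  ∑-split : ∀ m k (f : ℕ → ℚ) → ∑ (m ℕ.+ k) f ≡ ∑ m f + ∑ k (λ i → f (m ℕ.+ i))
  ∑-split zero k f = sym (ℚP.+-identityˡ _)
  ∑-split (suc m) k f =
    trans (cong (f 0 +_) (∑-split m k (λ i → f (suc i)))) (sym (ℚP.+-assoc (f 0) _ _))

  ∑-truncate : ∀ m k (f : ℕ → ℚ) → (∀ i → f (m ℕ.+ i) ≡ 0ℚ) → ∑ (m ℕ.+ k) f ≡ ∑ m f
  ∑-truncate m k f e =
    trans (∑-split m k f) (trans (cong (∑ m f +_) (∑-zero k (λ i _ → e i))) (ℚP.+-identityʳ _))

  ∑-swap : ∀ n m (f : ℕ → ℕ → ℚ) → ∑ n (λ i → ∑ m (f i)) ≡ ∑ m (λ j → ∑ n (λ i → f i j))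
  ∑-swap zero m f = sym (∑-zero m (λ _ _ → refl))
  ∑-swap (suc n) m f = trans (cong (∑ m (f 0) +_) (∑-swap n m (λ i → f (suc i))))
    (sym (∑-+ m (f 0) (λ j → ∑ n (λ i → f (suc i) j))))

  ∑-reverse : ∀ n (f : ℕ → ℚ) → ∑ n (λ r → f (n ∸ suc r)) ≡ ∑ n f
  ∑-reverse zero f = refl
  ∑-reverse (suc n) f = trans (cong (f n +_) (∑-reverse n f))
    (trans (ℚP.+-comm (f n) (∑ n f)) (sym (∑-snoc n f)))

  ∑-single : ∀ n j (f : ℕ → ℚ) → j < n → (∀ k → ¬ k ≡ j → f k ≡ 0ℚ) → ∑ n f ≡ f j
  ∑-single (suc n) zero f _ e =
    trans (cong (f 0 +_) (∑-zero n (λ k _ → e (suc k) (λ ())))) (ℚP.+-identityʳ (f 0))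
  ∑-single (suc n) (suc j) f (s<s j<n) e =
    trans (cong (_+ ∑ n (λ k → f (suc k))) (e 0 (λ ())))
    (trans (ℚP.+-identityˡ _)
      (∑-single n j (λ k → f (suc k)) j<n (λ k k≢j → e (suc k) (k≢j ∘ ℕP.suc-injective))))

  ∑-applyUpTo : ∀ n (f : ℕ → ℚ) (g : ℕ → ℕ) → sum (map f (applyUpTo g n)) ≡ ∑ n (λ k → f (g k))
  ∑-applyUpTo zero f g = refl
  ∑-applyUpTo (suc n) f g = cong (f (g 0) +_) (∑-applyUpTo n f (λ k → g (suc k)))

  Σ[⋯]≡∑ : ∀ lo hi (f : ℕ → ℚ) → Σ[ lo ⋯ hi ] f ≡ ∑ (suc hi ∸ lo) (λ k → f (lo ℕ.+ k))
  Σ[⋯]≡∑ lo hi f = trans (cong sum (sym (LP.map-∘ (upTo (suc hi ∸ lo)))))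
                          (∑-applyUpTo (suc hi ∸ lo) (λ k → f (lo ℕ.+ k)) (λ k → k))

module Binomials where
  open import Data.Nat
  open import Data.Nat.Properties
  open import Data.Nat.DivMod using (m/n*n≡m)
  open import Data.Nat.Combinatorics
  open import Relation.Binary.PropositionalEquality
  open import Data.Nat.Solver using (module +-*-Solver)
  open +-*-Solver
  open ≡-Reasoning

  binomial-factorials : ∀ {n k} → k ≤ n → (n C k) * (k ! * (n ∸ k) !) ≡ n !
  binomial-factorials {n} {k} k≤n =
    trans (cong (_* (k ! * (n ∸ k) !)) (nCk≡n!/k![n-k]! k≤n))
          (m/n*n≡m {{k !* (n ∸ k) !≢0}} (k![n∸k]!∣n! k≤n))

  binomial-factorials-+ : ∀ k m → ((k + m) C k) * (k ! * m !) ≡ (k + m) !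
  binomial-factorials-+ k m =
    subst (λ z → ((k + m) C k) * (k ! * z !) ≡ (k + m) !) (m+n∸m≡n k m)
          (binomial-factorials (m≤m+n k m))

  -- Choosing m+r out of m+K and then m out of those equals choosing m and
  -- then r out of the remaining K ("subset of a subset").
  binomial-revision : ∀ m r K → r ≤ K →
    ((m + K) C (m + r)) * ((m + r) C m) ≡ ((m + K) C m) * (K C r)
  binomial-revision m r K r≤K = *-cancelʳ-≡ _ _ (m ! * (r ! * s !)) {{factorials≢0}}
    (trans (cong (λ z → ((m + z) C (m + r)) * ((m + r) C m) * (m ! * (r ! * s !))) K≡r+s) (trans lhs (sym rhs)))
    where
    s : ℕ
    s = K ∸ r
    K≡r+s : K ≡ r + s
    K≡r+s = sym (m+[n∸m]≡n r≤K)
    factorials≢0 : NonZero (m ! * (r ! * s !))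
    factorials≢0 = m*n≢0 (m !) (r ! * s !) {{m !≢0}} {{r !* s !≢0}}
    lhs : ((m + (r + s)) C (m + r)) * ((m + r) C m) * (m ! * (r ! * s !)) ≡ (m + (r + s)) !
    lhs = begin
      ((m + (r + s)) C (m + r)) * ((m + r) C m) * (m ! * (r ! * s !))
        ≡⟨ solve 5 (λ A B M R S → A :* B :* (M :* (R :* S)) := A :* ((B :* (M :* R)) :* S)) refl
             ((m + (r + s)) C (m + r)) ((m + r) C m) (m !) (r !) (s !) ⟩
      ((m + (r + s)) C (m + r)) * ((((m + r) C m) * (m ! * r !)) * s !)
        ≡⟨ cong (λ z → ((m + (r + s)) C (m + r)) * (z * s !)) (binomial-factorials-+ m r) ⟩
      ((m + (r + s)) C (m + r)) * ((m + r) ! * s !)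
        ≡⟨ subst (λ z → (z C (m + r)) * ((m + r) ! * s !) ≡ z !) (+-assoc m r s)
                 (binomial-factorials-+ (m + r) s) ⟩
      (m + (r + s)) ! ∎
    rhs : ((m + K) C m) * (K C r) * (m ! * (r ! * s !)) ≡ (m + (r + s)) !
    rhs = begin
      ((m + K) C m) * (K C r) * (m ! * (r ! * s !))
        ≡⟨ solve 5 (λ A B M R S → A :* B :* (M :* (R :* S)) := A :* (M :* (B :* (R :* S)))) refl
             ((m + K) C m) (K C r) (m !) (r !) (s !) ⟩
      ((m + K) C m) * (m ! * ((K C r) * (r ! * s !)))
        ≡⟨ cong (λ z → ((m + K) C m) * (m ! * z)) (binomial-factorials r≤K) ⟩
      ((m + K) C m) * (m ! * K !)
        ≡⟨ binomial-factorials-+ m K ⟩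
      (m + K) !
        ≡⟨ cong (λ z → (m + z) !) K≡r+s ⟩
      (m + (r + s)) ! ∎

  -- One step of the rising factorial (K+1)(K+2)⋯(K+m) = C(K+m, m)·m!.
  rising-factorial-step : ∀ K m →
    ((K + suc m) C suc m) * (suc m) ! ≡ ((K + m) C m) * m ! * (K + suc m)
  rising-factorial-step K m = *-cancelʳ-≡ _ _ (K !) {{K !≢0}} (trans lhs (sym rhs))
    where
    lhs : ((K + suc m) C suc m) * (suc m) ! * K ! ≡ (K + suc m) !
    lhs = trans (*-assoc ((K + suc m) C suc m) _ _)
      (subst (λ z → (z C suc m) * ((suc m) ! * K !) ≡ z !) (+-comm (suc m) K)
             (binomial-factorials-+ (suc m) K))
    rhs : ((K + m) C m) * m ! * (K + suc m) * K ! ≡ (K + suc m) !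
    rhs = begin
      ((K + m) C m) * m ! * (K + suc m) * K !
        ≡⟨ solve 4 (λ A M S F → A :* M :* S :* F := S :* (A :* (M :* F))) refl
             ((K + m) C m) (m !) (K + suc m) (K !) ⟩
      (K + suc m) * (((K + m) C m) * (m ! * K !))
        ≡⟨ cong ((K + suc m) *_) (subst (λ z → (z C m) * (m ! * K !) ≡ z !) (+-comm m K)
                                          (binomial-factorials-+ m K)) ⟩
      (K + suc m) * (K + m) !
        ≡⟨ cong (λ z → z * (K + m) !) (+-suc K m) ⟩
      suc (K + m) !
        ≡⟨ cong _! (sym (+-suc K m)) ⟩
      (K + suc m) ! ∎

  C-suc-diagonal : ∀ n → suc n C n ≡ suc n
  C-suc-diagonal n =
    trans (nCk≡nC[n∸k] (n≤1+n n)) (trans (cong (suc n C_) (m+n∸n≡m 1 n)) (nC1≡n (suc n)))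

module Bernoulli where
  open import Defs
  open Casts
  open FiniteSums
  open Binomials using (C-suc-diagonal)
  open import Data.Nat as ℕ using (ℕ; zero; suc)
  open import Data.Nat.Combinatorics using (_C_)
  open import Data.Rational as ℚ using (ℚ; 0ℚ; 1ℚ; _+_; _*_; -_)
  open import Data.List as List using (List; []; _∷_; _++_; map; applyUpTo; upTo; zip; foldl)
  import Data.List.Properties as LP
  open import Data.Product using (_,_; proj₁; proj₂; _×_)
  open import Relation.Binary.PropositionalEquality
  open import Data.Rational.Solver using (module +-*-Solver)
  open +-*-Solver

  δ₁ : ℕ → ℚ
  δ₁ 1 = 1ℚ
  δ₁ _ = 0ℚ

  private
    map-applyUpTo-snoc : ∀ {A : Set} (f : ℕ → A) (g : ℕ → ℕ) n →
      map f (applyUpTo g (suc n)) ≡ map f (applyUpTo g n) ++ (f (g n) ∷ [])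
    map-applyUpTo-snoc f g zero = refl
    map-applyUpTo-snoc f g (suc n) = cong (f (g 0) ∷_) (map-applyUpTo-snoc f (λ k → g (suc k)) n)

    last : ∀ (xs : List ℚ) y → foldl (λ _ x → x) 0ℚ (xs ++ (y ∷ [])) ≡ y
    last xs y = LP.foldl-++ (λ _ x → x) 0ℚ xs (y ∷ [])

    sum-zip : ∀ (h : ℕ × ℚ → ℚ) (f : ℕ → ℚ) (g : ℕ → ℕ) m →
      sum (map h (zip (applyUpTo g m) (map f (applyUpTo g m)))) ≡ ∑ m (λ k → h (g k , f (g k)))
    sum-zip h f g zero = refl
    sum-zip h f g (suc m) = cong (h (g 0 , f (g 0)) +_) (sum-zip h f (λ k → g (suc k)) m)

  bernoulliUpTo≡table : ∀ n → bernoulliUpTo n ≡ map bernoulli (upTo (suc n))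
  bernoulliUpTo≡table zero = refl
  bernoulliUpTo≡table (suc n) =
    trans (cong (λ z → bernoulliUpTo n ++ (z ∷ [])) (sym (last (bernoulliUpTo n) _)))
    (trans (cong (_++ (bernoulli (suc n) ∷ [])) (bernoulliUpTo≡table n))
           (sym (map-applyUpTo-snoc bernoulli (λ k → k) (suc n))))

  bernoulli-suc : ∀ n →
    bernoulli (suc n) ≡ - (1/suc (suc n) * ∑ (suc n) (λ k → ℕ→ℚ (suc (suc n) C k) * bernoulli k))
  bernoulli-suc n = trans (last (bernoulliUpTo n) _)
    (cong (λ z → - (1/suc (suc n) * z))
      (trans (cong (λ z → sum (map term (zip (upTo (suc n)) z))) (bernoulliUpTo≡table n))
             (sum-zip term bernoulli (λ k → k) (suc n))))
    where
    term : ℕ × ℚ → ℚ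
    term p = ℕ→ℚ (suc (suc n) C proj₁ p) * proj₂ p

  bernoulli-recurrence : ∀ K → ∑ K (λ k → ℕ→ℚ (K C k) * bernoulli k) ≡ δ₁ K
  bernoulli-recurrence zero = refl
  bernoulli-recurrence (suc zero) = refl
  bernoulli-recurrence (suc (suc n)) = begin
    ∑ (suc (suc n)) h
      ≡⟨ ∑-snoc (suc n) h ⟩
    T + ℕ→ℚ (suc (suc n) C suc n) * bernoulli (suc n)
      ≡⟨ cong₂ (λ x y → T + ℕ→ℚ x * y) (C-suc-diagonal (suc n)) (bernoulli-suc n) ⟩
    T + c * (- (d * T))
      ≡⟨ solve 3 (λ t c d → t :+ c :* (:- (d :* t)) := t :* (con 1ℚ :+ :- (d :* c))) refl T c d ⟩
    T * (1ℚ + - (d * c))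
      ≡⟨ cong (λ z → T * (1ℚ + - z)) (1/suc-inverse (suc n)) ⟩
    T * (1ℚ + - 1ℚ)
      ≡⟨ solve 1 (λ t → t :* (con 1ℚ :+ :- con 1ℚ) := con 0ℚ) refl T ⟩
    0ℚ ∎
    where
    open ≡-Reasoning
    h : ℕ → ℚ
    h k = ℕ→ℚ (suc (suc n) C k) * bernoulli k
    T : ℚ
    T = ∑ (suc n) h
    c : ℚ
    c = ℕ→ℚ (suc (suc n))
    d : ℚ
    d = 1/suc (suc n)

module Powers where
  open import Defs
  open Casts
  open FiniteSums
  open import Data.Nat as ℕ using (ℕ; zero; suc; _∸_; s<s)
  import Data.Nat.Properties as ℕP
  open import Data.Nat.Combinatorics using (_C_; nCk+nC[k+1]≡[n+1]C[k+1]; k>n⇒nCk≡0)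
  open import Data.Rational as ℚ using (ℚ; 0ℚ; 1ℚ; _+_; _*_; -_)
  import Data.Rational.Properties as ℚP
  open import Relation.Binary.PropositionalEquality
  open import Data.Rational.Solver using (module +-*-Solver)
  open +-*-Solver
  open ≡-Reasoning

  Cℚ : ℕ → ℕ → ℚ
  Cℚ n k = ℕ→ℚ (n C k)

  sign : ℕ → ℚ
  sign s = (- 1ℚ) ^ℚ s

  ^-+ : ∀ x a b → x ^ℚ (a ℕ.+ b) ≡ x ^ℚ a * x ^ℚ b
  ^-+ x zero b = sym (ℚP.*-identityˡ _)
  ^-+ x (suc a) b = trans (cong (x *_) (^-+ x a b)) (sym (ℚP.*-assoc x _ _))

  ^-* : ∀ x y n → (x * y) ^ℚ n ≡ x ^ℚ n * y ^ℚ n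
  ^-* x y zero = sym (ℚP.*-identityˡ 1ℚ)
  ^-* x y (suc n) = trans (cong ((x * y) *_) (^-* x y n))
    (solve 4 (λ a b c d → (a :* b) :* (c :* d) := (a :* c) :* (b :* d)) refl x y (x ^ℚ n) (y ^ℚ n))

  ^-neg : ∀ x n → (- x) ^ℚ n ≡ sign n * x ^ℚ n
  ^-neg x n = trans (cong (_^ℚ n) (solve 1 (λ a → :- a := :- con 1ℚ :* a) refl x)) (^-* (- 1ℚ) x n)

  sign-square : ∀ n → sign n * sign n ≡ 1ℚ
  sign-square zero = ℚP.*-identityˡ 1ℚ
  sign-square (suc n) =
    trans (solve 1 (λ s → (:- con 1ℚ :* s) :* (:- con 1ℚ :* s) := s :* s) refl (sign n)) (sign-square n)

  sign-∸ : ∀ {N i} → i ℕ.≤ N → sign N * sign i ≡ sign (N ∸ i)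
  sign-∸ {N} {i} i≤N = begin
    sign N * sign i               ≡⟨ cong (λ z → sign z * sign i) (sym (ℕP.m∸n+n≡m i≤N)) ⟩
    sign (N ∸ i ℕ.+ i) * sign i   ≡⟨ cong (_* sign i) (^-+ (- 1ℚ) (N ∸ i) i) ⟩
    sign (N ∸ i) * sign i * sign i ≡⟨ ℚP.*-assoc (sign (N ∸ i)) _ _ ⟩
    sign (N ∸ i) * (sign i * sign i) ≡⟨ cong (sign (N ∸ i) *_) (sign-square i) ⟩
    sign (N ∸ i) * 1ℚ             ≡⟨ ℚP.*-identityʳ _ ⟩
    sign (N ∸ i) ∎

  -- (x+1)^i = ∑_{m<M} C(i,m) x^m for any M > i (the terms m > i vanish).
  binomial-theorem : ∀ (x : ℚ) i M → i ℕ.< M → (x + 1ℚ) ^ℚ i ≡ ∑ M (λ m → Cℚ i m * x ^ℚ m)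
  binomial-theorem x zero (suc M) _ =
    sym (trans (cong (Cℚ 0 0 * 1ℚ +_) (∑-zero M (λ k _ → ℚP.*-zeroˡ (x ^ℚ suc k)))) (ℚP.+-identityʳ _))
  binomial-theorem x (suc i) (suc M) (s<s i<M) = begin
    (x + 1ℚ) * (x + 1ℚ) ^ℚ i
      ≡⟨ cong ((x + 1ℚ) *_) (binomial-theorem x i (suc M) (ℕP.m<n⇒m<1+n i<M)) ⟩
    (x + 1ℚ) * (1ℚ * 1ℚ + A)
      ≡⟨ solve 2 (λ x a → (x :+ con 1ℚ) :* (con 1ℚ :* con 1ℚ :+ a) := con 1ℚ :+ ((x :+ x :* a) :+ a)) refl x A ⟩
    1ℚ + ((x + x * A) + A)
      ≡⟨ cong (λ z → 1ℚ + (z + A)) shifted ⟩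
    1ℚ + (∑ M (λ m → Cℚ i m * x ^ℚ suc m) + A)
      ≡⟨ cong (1ℚ +_) (sym (∑-+ M (λ m → Cℚ i m * x ^ℚ suc m) (λ m → Cℚ i (suc m) * x ^ℚ suc m))) ⟩
    1ℚ + ∑ M (λ m → Cℚ i m * x ^ℚ suc m + Cℚ i (suc m) * x ^ℚ suc m)
      ≡⟨ cong (1ℚ +_) (∑-cong M pascal) ⟩
    1ℚ + ∑ M (λ m → Cℚ (suc i) (suc m) * x ^ℚ suc m)
      ≡⟨ cong (_+ ∑ M (λ m → Cℚ (suc i) (suc m) * x ^ℚ suc m)) (sym (ℚP.*-identityˡ 1ℚ)) ⟩
    ∑ (suc M) (λ m → Cℚ (suc i) m * x ^ℚ m) ∎
    where
    A : ℚ
    A = ∑ M (λ m → Cℚ i (suc m) * x ^ℚ suc m)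
    g : ℕ → ℚ
    g = λ m → Cℚ i m * x ^ℚ suc m
    -- x·(x+1)^i, written out, is the sum of the shifted terms; its last term C(i,M) vanishes.
    shifted : x + x * A ≡ ∑ M g
    shifted = begin
      x + x * A
        ≡⟨ cong₂ _+_ (solve 1 (λ x → x := con 1ℚ :* (x :* con 1ℚ)) refl x)
             (trans (∑-*ˡ M x _) (∑-cong M (λ m → solve 3 (λ a x p → x :* (a :* p) := a :* (x :* p)) refl
                                                    (Cℚ i (suc m)) x (x ^ℚ suc m)))) ⟩
      ∑ (suc M) g
        ≡⟨ ∑-snoc M g ⟩
      ∑ M g + ℕ→ℚ (i C M) * x ^ℚ suc M
        ≡⟨ cong (λ z → ∑ M g + ℕ→ℚ z * x ^ℚ suc M) (k>n⇒nCk≡0 i<M) ⟩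
      ∑ M g + 0ℚ * x ^ℚ suc M
        ≡⟨ solve 2 (λ s p → s :+ con 0ℚ :* p := s) refl (∑ M g) (x ^ℚ suc M) ⟩
      ∑ M g ∎
    pascal : ∀ m → Cℚ i m * x ^ℚ suc m + Cℚ i (suc m) * x ^ℚ suc m ≡ Cℚ (suc i) (suc m) * x ^ℚ suc m
    pascal m = trans (sym (ℚP.*-distribʳ-+ (x ^ℚ suc m) (Cℚ i m) (Cℚ i (suc m))))
      (cong (_* x ^ℚ suc m) (trans (sym (ℕ→ℚ-+ (i C m) (i C suc m)))
                                   (cong ℕ→ℚ (nCk+nC[k+1]≡[n+1]C[k+1] i m))))

module Faulhaber where
  -- It follows by telescoping from the difference equation of the Bernoulli
  -- polynomials  B_{j+1}(x+1) - B_{j+1}(x) = (j+1) x^j, which is itself the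
  -- binomial theorem combined with the Bernoulli recurrence.
  open import Defs
  open Casts
  open FiniteSums
  open Binomials using (binomial-revision; C-suc-diagonal)
  open Bernoulli using (δ₁; bernoulli-recurrence)
  open Powers
  open import Data.Nat as ℕ using (ℕ; zero; suc; _∸_; s≤s)
  import Data.Nat.Properties as ℕP
  open import Data.Nat.Combinatorics using (_C_; nCn≡1; nCk≡nC[n∸k]; k>n⇒nCk≡0)
  open import Data.Rational as ℚ using (ℚ; 0ℚ; 1ℚ; _+_; _*_; -_)
  import Data.Rational.Properties as ℚP
  open import Data.Product using (_,_)
  open import Relation.Binary.PropositionalEquality
  open import Relation.Nullary using (¬_; contradiction)
  open import Function using (_∘_)
  open import Data.Rational.Solver using (module +-*-Solver)
  open +-*-Solver
  open ≡-Reasoning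

  private
    B : ℕ → ℚ
    B = bernoulli

  bernoulliPoly : ℕ → ℚ → ℚ
  bernoulliPoly N x = ∑ (suc N) (λ i → Cℚ N i * B (N ∸ i) * x ^ℚ i)

  -- ∑_i C(m+K,i) C(i,m) B_{m+K-i} = C(m+K,m) (B_K + [K = 1]): by the revision
  -- identity the sum is C(m+K,m) ∑_{q ≤ K} C(K,q) B_q, and the recurrence applies.
  bernoulli-convolution : ∀ m K →
    ∑ (suc (m ℕ.+ K)) (λ i → Cℚ (m ℕ.+ K) i * Cℚ i m * B ((m ℕ.+ K) ∸ i))
      ≡ Cℚ (m ℕ.+ K) m * (B K + δ₁ K)
  bernoulli-convolution m K = begin
    ∑ (suc N) f
      ≡⟨ cong (λ z → ∑ z f) (sym (ℕP.+-suc m K)) ⟩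
    ∑ (m ℕ.+ suc K) f
      ≡⟨ ∑-split m (suc K) f ⟩
    ∑ m f + ∑ (suc K) (λ r → f (m ℕ.+ r))
      ≡⟨ cong₂ _+_ (∑-zero m below-m) (∑-cong-< (suc K) revised) ⟩
    0ℚ + ∑ (suc K) (λ r → Cℚ N m * g (K ∸ r))
      ≡⟨ trans (ℚP.+-identityˡ _) (sym (∑-*ˡ (suc K) (Cℚ N m) (λ r → g (K ∸ r)))) ⟩
    Cℚ N m * ∑ (suc K) (λ r → g (K ∸ r))
      ≡⟨ cong (Cℚ N m *_) (trans (∑-reverse (suc K) g) (∑-snoc K g)) ⟩
    Cℚ N m * (∑ K g + g K)
      ≡⟨ cong (λ z → Cℚ N m * (z + g K)) (bernoulli-recurrence K) ⟩
    Cℚ N m * (δ₁ K + Cℚ K K * B K)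
      ≡⟨ cong (Cℚ N m *_) last-term ⟩
    Cℚ N m * (B K + δ₁ K) ∎
    where
    N : ℕ
    N = m ℕ.+ K
    f : ℕ → ℚ
    f = λ i → Cℚ N i * Cℚ i m * B (N ∸ i)
    g : ℕ → ℚ
    g = λ q → Cℚ K q * B q
    below-m : ∀ i → i ℕ.< m → f i ≡ 0ℚ
    below-m i i<m = trans (cong (λ z → Cℚ N i * ℕ→ℚ z * B (N ∸ i)) (k>n⇒nCk≡0 i<m))
      (solve 2 (λ a b → a :* con 0ℚ :* b := con 0ℚ) refl (Cℚ N i) (B (N ∸ i)))
    revised : ∀ r → r ℕ.< suc K → f (m ℕ.+ r) ≡ Cℚ N m * g (K ∸ r)
    revised r (s≤s r≤K) = begin
      Cℚ N (m ℕ.+ r) * Cℚ (m ℕ.+ r) m * B (N ∸ (m ℕ.+ r))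
        ≡⟨ cong₂ _*_ (sym (ℕ→ℚ-* (N C (m ℕ.+ r)) ((m ℕ.+ r) C m))) (cong B (ℕP.[m+n]∸[m+o]≡n∸o m K r)) ⟩
      ℕ→ℚ ((N C (m ℕ.+ r)) ℕ.* ((m ℕ.+ r) C m)) * B (K ∸ r)
        ≡⟨ cong (λ z → ℕ→ℚ z * B (K ∸ r)) (binomial-revision m r K r≤K) ⟩
      ℕ→ℚ ((N C m) ℕ.* (K C r)) * B (K ∸ r)
        ≡⟨ cong (_* B (K ∸ r)) (ℕ→ℚ-* (N C m) (K C r)) ⟩
      Cℚ N m * Cℚ K r * B (K ∸ r)
        ≡⟨ cong (λ z → Cℚ N m * ℕ→ℚ z * B (K ∸ r)) (nCk≡nC[n∸k] r≤K) ⟩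
      Cℚ N m * Cℚ K (K ∸ r) * B (K ∸ r)
        ≡⟨ ℚP.*-assoc (Cℚ N m) _ _ ⟩
      Cℚ N m * g (K ∸ r) ∎
    last-term : δ₁ K + Cℚ K K * B K ≡ B K + δ₁ K
    last-term = trans (cong (λ z → δ₁ K + ℕ→ℚ z * B K) (nCn≡1 K))
                      (trans (cong (δ₁ K +_) (ℚP.*-identityˡ (B K))) (ℚP.+-comm (δ₁ K) (B K)))

  bernoulli-convolution-≤ : ∀ N m → m ℕ.≤ N →
    ∑ (suc N) (λ i → Cℚ N i * Cℚ i m * B (N ∸ i)) ≡ Cℚ N m * (B (N ∸ m) + δ₁ (N ∸ m))
  bernoulli-convolution-≤ N m m≤N with ℕP.m≤n⇒∃[o]m+o≡n m≤N
  ... | K , refl =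
    subst (λ w → ∑ (suc (m ℕ.+ K)) (λ i → Cℚ (m ℕ.+ K) i * Cℚ i m * B ((m ℕ.+ K) ∸ i))
                   ≡ Cℚ (m ℕ.+ K) m * (B w + δ₁ w))
          (sym (ℕP.m+n∸m≡n m K)) (bernoulli-convolution m K)

  -- Expanding (x+1)^i binomially and exchanging the sums.
  bernoulliPoly-shift : ∀ N x →
    bernoulliPoly N (x + 1ℚ) ≡ bernoulliPoly N x + ∑ (suc N) (λ m → x ^ℚ m * (Cℚ N m * δ₁ (N ∸ m)))
  bernoulliPoly-shift N x = begin
    ∑ (suc N) (λ i → cB i * (x + 1ℚ) ^ℚ i)
      ≡⟨ ∑-cong-< (suc N) (λ i i<sN → trans (cong (cB i *_) (binomial-theorem x i (suc N) i<sN))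
                                           (∑-*ˡ (suc N) (cB i) (λ m → Cℚ i m * x ^ℚ m))) ⟩
    ∑ (suc N) (λ i → ∑ (suc N) (λ m → cB i * (Cℚ i m * x ^ℚ m)))
      ≡⟨ ∑-swap (suc N) (suc N) (λ i m → cB i * (Cℚ i m * x ^ℚ m)) ⟩
    ∑ (suc N) (λ m → ∑ (suc N) (λ i → cB i * (Cℚ i m * x ^ℚ m)))
      ≡⟨ ∑-cong (suc N) (λ m → trans (∑-cong (suc N) (λ i → regroup i m))
                                      (sym (∑-*ˡ (suc N) (x ^ℚ m) (λ i → Cℚ N i * Cℚ i m * B (N ∸ i))))) ⟩
    ∑ (suc N) (λ m → x ^ℚ m * ∑ (suc N) (λ i → Cℚ N i * Cℚ i m * B (N ∸ i)))
      ≡⟨ ∑-cong-< (suc N) (λ m m<sN → cong (x ^ℚ m *_) (bernoulli-convolution-≤ N m (ℕP.≤-pred m<sN))) ⟩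
    ∑ (suc N) (λ m → x ^ℚ m * (Cℚ N m * (B (N ∸ m) + δ₁ (N ∸ m))))
      ≡⟨ ∑-cong (suc N) (λ m → solve 4 (λ p a b d → p :* (a :* (b :+ d)) := a :* b :* p :+ p :* (a :* d))
                                         refl (x ^ℚ m) (Cℚ N m) (B (N ∸ m)) (δ₁ (N ∸ m))) ⟩
    ∑ (suc N) (λ m → Cℚ N m * B (N ∸ m) * x ^ℚ m + x ^ℚ m * (Cℚ N m * δ₁ (N ∸ m)))
      ≡⟨ ∑-+ (suc N) (λ m → Cℚ N m * B (N ∸ m) * x ^ℚ m) (λ m → x ^ℚ m * (Cℚ N m * δ₁ (N ∸ m))) ⟩
    bernoulliPoly N x + ∑ (suc N) (λ m → x ^ℚ m * (Cℚ N m * δ₁ (N ∸ m))) ∎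
    where
    cB : ℕ → ℚ
    cB = λ i → Cℚ N i * B (N ∸ i)
    regroup : ∀ i m → cB i * (Cℚ i m * x ^ℚ m) ≡ x ^ℚ m * (Cℚ N i * Cℚ i m * B (N ∸ i))
    regroup i m = solve 4 (λ a b d p → (a :* b) :* (d :* p) := p :* (a :* d :* b)) refl
                    (Cℚ N i) (B (N ∸ i)) (Cℚ i m) (x ^ℚ m)

  private
    δ₁-off : ∀ j m → ¬ m ≡ j → δ₁ (suc j ∸ m) ≡ 0ℚ
    δ₁-off zero zero m≢j = contradiction refl m≢j
    δ₁-off zero (suc m) _ = cong δ₁ (ℕP.0∸n≡0 m)
    δ₁-off (suc j) zero _ = refl
    δ₁-off (suc j) (suc m) m≢j = δ₁-off j m (m≢j ∘ cong suc)

  -- Only the term m = j of the correction survives.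
  bernoulliPoly-difference : ∀ j x →
    bernoulliPoly (suc j) (x + 1ℚ) ≡ bernoulliPoly (suc j) x + ℕ→ℚ (suc j) * x ^ℚ j
  bernoulliPoly-difference j x =
    trans (bernoulliPoly-shift (suc j) x) (cong (bernoulliPoly (suc j) x +_) (trans
      (∑-single (suc (suc j)) j _ (ℕP.m<n⇒m<1+n (ℕP.n<1+n j)) vanish)
      (trans (cong₂ (λ u v → x ^ℚ j * (ℕ→ℚ u * δ₁ v)) (C-suc-diagonal j) (ℕP.m+n∸n≡m 1 j))
             (solve 2 (λ p n → p :* (n :* con 1ℚ) := n :* p) refl (x ^ℚ j) (ℕ→ℚ (suc j))))))
    where
    vanish : ∀ m → ¬ m ≡ j → x ^ℚ m * (Cℚ (suc j) m * δ₁ (suc j ∸ m)) ≡ 0ℚ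
    vanish m m≢j = trans (cong (λ z → x ^ℚ m * (Cℚ (suc j) m * z)) (δ₁-off j m m≢j))
                         (solve 2 (λ a b → a :* (b :* con 0ℚ) := con 0ℚ) refl (x ^ℚ m) (Cℚ (suc j) m))

  -- The Bernoulli polynomial for the convention B₁ = +1/2:
  -- B⁺_N(x) = ∑_i (-1)^{N-i} C(N,i) B_{N-i} x^i = (-1)^N B_N(-x).
  bernoulliPoly⁺ : ℕ → ℚ → ℚ
  bernoulliPoly⁺ N x = ∑ (suc N) (λ i → sign (N ∸ i) * Cℚ N i * B (N ∸ i) * x ^ℚ i)

  bernoulliPoly⁺-reflection : ∀ N x → bernoulliPoly⁺ N x ≡ sign N * bernoulliPoly N (- x)
  bernoulliPoly⁺-reflection N x =
    sym (trans (∑-*ˡ (suc N) (sign N) (λ i → Cℚ N i * B (N ∸ i) * (- x) ^ℚ i)) (∑-cong-< (suc N) term))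
    where
    term : ∀ i → i ℕ.< suc N →
      sign N * (Cℚ N i * B (N ∸ i) * (- x) ^ℚ i) ≡ sign (N ∸ i) * Cℚ N i * B (N ∸ i) * x ^ℚ i
    term i i<sN = trans (cong (λ z → sign N * (Cℚ N i * B (N ∸ i) * z)) (^-neg x i))
      (trans (solve 5 (λ sN a b si p → sN :* (a :* b :* (si :* p)) := (sN :* si) :* a :* b :* p) refl
                      (sign N) (Cℚ N i) (B (N ∸ i)) (sign i) (x ^ℚ i))
             (cong (λ z → z * Cℚ N i * B (N ∸ i) * x ^ℚ i) (sign-∸ (ℕP.≤-pred i<sN))))

  bernoulliPoly⁺-difference : ∀ j x →
    bernoulliPoly⁺ (suc j) (x + 1ℚ) ≡ bernoulliPoly⁺ (suc j) x + ℕ→ℚ (suc j) * (x + 1ℚ) ^ℚ j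
  bernoulliPoly⁺-difference j x = begin
    bernoulliPoly⁺ (suc j) (x + 1ℚ)
      ≡⟨ bernoulliPoly⁺-reflection (suc j) (x + 1ℚ) ⟩
    sign (suc j) * β₁
      ≡⟨ cong (sign (suc j) *_) (solve 2 (λ b d → b := (b :+ d) :+ :- d) refl β₁ (n * (s * p))) ⟩
    sign (suc j) * ((β₁ + n * (s * p)) + - (n * (s * p)))
      ≡⟨ cong (λ z → sign (suc j) * (z + - (n * (s * p)))) (sym shift) ⟩
    sign (suc j) * (β₀ + - (n * (s * p)))
      ≡⟨ solve 4 (λ s b n p → (:- con 1ℚ :* s) :* (b :+ :- (n :* (s :* p))) := (:- con 1ℚ :* s) :* b :+ n :* p :* (s :* s))
                 refl s β₀ n p ⟩
    sign (suc j) * β₀ + n * p * (s * s)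
      ≡⟨ cong₂ (λ u v → u + n * p * v) (sym (bernoulliPoly⁺-reflection (suc j) x)) (sign-square j) ⟩
    bernoulliPoly⁺ (suc j) x + n * p * 1ℚ
      ≡⟨ cong (bernoulliPoly⁺ (suc j) x +_) (ℚP.*-identityʳ (n * p)) ⟩
    bernoulliPoly⁺ (suc j) x + n * p ∎
    where
    n : ℚ
    n = ℕ→ℚ (suc j)
    s : ℚ
    s = sign j
    p : ℚ
    p = (x + 1ℚ) ^ℚ j
    β₀ : ℚ
    β₀ = bernoulliPoly (suc j) (- x)
    β₁ : ℚ
    β₁ = bernoulliPoly (suc j) (- (x + 1ℚ))
    shift : β₀ ≡ β₁ + n * (s * p)
    shift = trans (cong (bernoulliPoly (suc j)) (solve 1 (λ x → :- x := :- (x :+ con 1ℚ) :+ con 1ℚ) refl x))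
      (trans (bernoulliPoly-difference j (- (x + 1ℚ))) (cong (λ z → β₁ + n * z) (^-neg (x + 1ℚ) j)))

  faulhaberPoly : ℕ → ℚ → ℚ
  faulhaberPoly j x = ∑ (suc j) (λ i → sign (j ∸ i) * Cℚ (suc j) (suc i) * B (j ∸ i) * x ^ℚ suc i)

  faulhaberPoly≡ : ∀ j x → bernoulliPoly⁺ (suc j) x + - bernoulliPoly⁺ (suc j) 0ℚ ≡ faulhaberPoly j x
  faulhaberPoly≡ j x =
    trans (cong (λ z → bernoulliPoly⁺ (suc j) x + - (h₀ + z)) (∑-zero (suc j) (λ i _ → vanish i)))
          (solve 2 (λ h P → h :+ P :+ :- (h :+ con 0ℚ) := P) refl h₀ (faulhaberPoly j x))
    where
    h₀ : ℚ
    h₀ = sign (suc j) * Cℚ (suc j) 0 * B (suc j) * 1ℚ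
    vanish : ∀ i → sign (j ∸ i) * Cℚ (suc j) (suc i) * B (j ∸ i) * (0ℚ * 0ℚ ^ℚ i) ≡ 0ℚ
    vanish i = solve 4 (λ a b d p → a :* b :* d :* (con 0ℚ :* p) := con 0ℚ) refl
                 (sign (j ∸ i)) (Cℚ (suc j) (suc i)) (B (j ∸ i)) (0ℚ ^ℚ i)

  faulhaber : ∀ j t → ℕ→ℚ (suc j) * ∑ t (λ k → ℕ→ℚ (suc k) ^ℚ j) ≡ faulhaberPoly j (ℕ→ℚ t)
  faulhaber j t = trans (telescope t) (faulhaberPoly≡ j (ℕ→ℚ t))
    where
    n : ℚ
    n = ℕ→ℚ (suc j)
    β⁺ : ℚ → ℚ
    β⁺ = bernoulliPoly⁺ (suc j)
    f : ℕ → ℚ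
    f = λ k → ℕ→ℚ (suc k) ^ℚ j
    telescope : ∀ t → n * ∑ t f ≡ β⁺ (ℕ→ℚ t) + - β⁺ 0ℚ
    telescope zero = solve 2 (λ n b → n :* con 0ℚ := b :+ :- b) refl n (β⁺ 0ℚ)
    telescope (suc t) = begin
      n * ∑ (suc t) f
        ≡⟨ trans (cong (n *_) (∑-snoc t f)) (ℚP.*-distribˡ-+ n (∑ t f) (f t)) ⟩
      n * ∑ t f + n * f t
        ≡⟨ cong (_+ n * f t) (telescope t) ⟩
      β⁺ (ℕ→ℚ t) + - β⁺ 0ℚ + n * f t
        ≡⟨ solve 3 (λ a b d → a :+ :- b :+ d := (a :+ d) :+ :- b) refl (β⁺ (ℕ→ℚ t)) (β⁺ 0ℚ) (n * f t) ⟩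
      β⁺ (ℕ→ℚ t) + n * f t + - β⁺ 0ℚ
        ≡⟨ cong (λ z → β⁺ (ℕ→ℚ t) + n * z ^ℚ j + - β⁺ 0ℚ) suc≡+1 ⟩
      β⁺ (ℕ→ℚ t) + n * (ℕ→ℚ t + 1ℚ) ^ℚ j + - β⁺ 0ℚ
        ≡⟨ cong (_+ - β⁺ 0ℚ) (sym (bernoulliPoly⁺-difference j (ℕ→ℚ t))) ⟩
      β⁺ (ℕ→ℚ t + 1ℚ) + - β⁺ 0ℚ
        ≡⟨ cong (λ z → β⁺ z + - β⁺ 0ℚ) (sym suc≡+1) ⟩
      β⁺ (ℕ→ℚ (suc t)) + - β⁺ 0ℚ ∎
      where
      suc≡+1 : ℕ→ℚ (suc t) ≡ ℕ→ℚ t + 1ℚ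
      suc≡+1 = trans (ℕ→ℚ-suc t) (ℚP.+-comm 1ℚ (ℕ→ℚ t))

module SymmetricProducts where
  open import Defs
  open Casts
  open FiniteSums
  open Binomials using (rising-factorial-step)
  open import Data.Nat as ℕ using (ℕ; zero; suc; _∸_; z≤n; s≤s; _!)
  import Data.Nat.Properties as ℕP
  open import Data.Nat.Combinatorics using (_C_)
  open import Data.Rational as ℚ using (ℚ; 0ℚ; 1ℚ; _+_; _*_)
  import Data.Rational.Properties as ℚP
  open import Data.List as List using (List; []; _∷_; _++_; map; upTo; length)
  import Data.List.Properties as LP
  open import Relation.Binary.PropositionalEquality
  open import Data.Sum using (inj₁; inj₂)
  open import Data.Rational.Solver using (module +-*-Solver)
  open +-*-Solver
  open ≡-Reasoning

  shiftedProduct : List ℚ → ℚ → ℚ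
  shiftedProduct [] k = 1ℚ
  shiftedProduct (x ∷ xs) k = (k + x) * shiftedProduct xs k

  -- coeff xs j is the coefficient of k^j in shiftedProduct xs k.
  coeff : List ℚ → ℕ → ℚ
  coeff [] zero = 1ℚ
  coeff [] (suc j) = 0ℚ
  coeff (x ∷ xs) zero = x * coeff xs zero
  coeff (x ∷ xs) (suc j) = coeff xs j + x * coeff xs (suc j)

  esym-above-length : ∀ xs ℓ → length xs ℕ.< ℓ → esym xs ℓ ≡ 0ℚ
  esym-above-length [] (suc ℓ) _ = refl
  esym-above-length (x ∷ xs) (suc ℓ) (s≤s n<ℓ) =
    trans (cong₂ (λ u v → u + x * v) (esym-above-length xs (suc ℓ) (ℕP.m<n⇒m<1+n n<ℓ))
                                     (esym-above-length xs ℓ n<ℓ))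
          (solve 1 (λ x → con 0ℚ :+ x :* con 0ℚ := con 0ℚ) refl x)

  coeff-above-length : ∀ xs j → length xs ℕ.< j → coeff xs j ≡ 0ℚ
  coeff-above-length [] (suc j) _ = refl
  coeff-above-length (x ∷ xs) (suc j) (s≤s n<j) =
    trans (cong₂ (λ u v → u + x * v) (coeff-above-length xs j n<j)
                                     (coeff-above-length xs (suc j) (ℕP.m<n⇒m<1+n n<j)))
          (solve 1 (λ x → con 0ℚ :+ x :* con 0ℚ := con 0ℚ) refl x)

  shiftedProduct-expansion : ∀ xs k M → length xs ℕ.< M →
    ∑ M (λ j → coeff xs j * k ^ℚ j) ≡ shiftedProduct xs k
  shiftedProduct-expansion [] k (suc M) _ =
    trans (cong (1ℚ * 1ℚ +_) (∑-zero M (λ j _ → ℚP.*-zeroˡ (k ^ℚ suc j))))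
          (trans (ℚP.+-identityʳ _) (ℚP.*-identityˡ 1ℚ))
  shiftedProduct-expansion (x ∷ xs) k (suc M) (s≤s n<M) = begin
    x * c 0 * 1ℚ + ∑ M (λ j → (c j + x * c (suc j)) * k ^ℚ suc j)
      ≡⟨ cong (x * c 0 * 1ℚ +_) (trans (∑-cong M split) (∑-+ M _ _)) ⟩
    x * c 0 * 1ℚ + (∑ M (λ j → k * (c j * k ^ℚ j)) + ∑ M (λ j → x * (c (suc j) * k ^ℚ suc j)))
      ≡⟨ cong₂ (λ u v → x * c 0 * 1ℚ + (u + v)) (sym (∑-*ˡ M k _)) (sym (∑-*ˡ M x _)) ⟩
    x * c 0 * 1ℚ + (k * ∑ M (λ j → c j * k ^ℚ j) + x * ∑ M (λ j → c (suc j) * k ^ℚ suc j))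
      ≡⟨ solve 4 (λ x a P Q → x :* a :* con 1ℚ :+ (P :+ x :* Q) := P :+ x :* (a :* con 1ℚ :+ Q)) refl
           x (c 0) (k * ∑ M (λ j → c j * k ^ℚ j)) (∑ M (λ j → c (suc j) * k ^ℚ suc j)) ⟩
    k * ∑ M (λ j → c j * k ^ℚ j) + x * ∑ (suc M) (λ j → c j * k ^ℚ j)
      ≡⟨ cong₂ (λ u v → k * u + x * v) (shiftedProduct-expansion xs k M n<M)
                                       (shiftedProduct-expansion xs k (suc M) (ℕP.m<n⇒m<1+n n<M)) ⟩
    k * shiftedProduct xs k + x * shiftedProduct xs k
      ≡⟨ sym (ℚP.*-distribʳ-+ (shiftedProduct xs k) k x) ⟩
    (k + x) * shiftedProduct xs k ∎
    where
    c : ℕ → ℚ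
    c = coeff xs
    split : ∀ j → (c j + x * c (suc j)) * k ^ℚ suc j ≡ k * (c j * k ^ℚ j) + x * (c (suc j) * k ^ℚ suc j)
    split j = solve 5 (λ a b x k p → (a :+ x :* b) :* (k :* p) := k :* (a :* p) :+ x :* (b :* (k :* p))) refl
                (c j) (c (suc j)) x k (k ^ℚ j)

  esym-zero : ∀ xs → esym xs 0 ≡ 1ℚ
  esym-zero [] = refl
  esym-zero (x ∷ xs) = refl

  coeff≡esym : ∀ xs j → j ℕ.≤ length xs → coeff xs j ≡ esym xs (length xs ∸ j)
  coeff≡esym [] zero _ = refl
  coeff≡esym (x ∷ xs) zero _ = trans (cong (x *_) (coeff≡esym xs 0 z≤n))
    (sym (trans (cong (_+ x * esym xs (length xs)) (esym-above-length xs (suc (length xs)) (ℕP.n<1+n _)))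
                (ℚP.+-identityˡ _)))
  coeff≡esym (x ∷ xs) (suc j) (s≤s j≤n) with ℕP.m≤n⇒m<n∨m≡n j≤n
  ... | inj₂ refl = begin
    coeff xs j + x * coeff xs (suc j)
      ≡⟨ cong₂ (λ u v → u + x * v) (coeff≡esym xs j j≤n) (coeff-above-length xs (suc j) (ℕP.n<1+n j)) ⟩
    esym xs (j ∸ j) + x * 0ℚ
      ≡⟨ cong (λ z → esym xs z + x * 0ℚ) (ℕP.n∸n≡0 j) ⟩
    esym xs 0 + x * 0ℚ
      ≡⟨ cong (_+ x * 0ℚ) (esym-zero xs) ⟩
    1ℚ + x * 0ℚ
      ≡⟨ solve 1 (λ x → con 1ℚ :+ x :* con 0ℚ := con 1ℚ) refl x ⟩
    1ℚ
      ≡⟨ cong (esym (x ∷ xs)) (sym (ℕP.n∸n≡0 j)) ⟩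
    esym (x ∷ xs) (j ∸ j) ∎
  ... | inj₁ j<n = begin
    coeff xs j + x * coeff xs (suc j)
      ≡⟨ cong₂ (λ u v → u + x * v) (coeff≡esym xs j j≤n) (coeff≡esym xs (suc j) j<n) ⟩
    esym xs (length xs ∸ j) + x * esym xs (length xs ∸ suc j)
      ≡⟨ cong (λ z → esym xs z + x * esym xs (length xs ∸ suc j)) n∸j≡suc ⟩
    esym (x ∷ xs) (suc (length xs ∸ suc j))
      ≡⟨ cong (esym (x ∷ xs)) (sym n∸j≡suc) ⟩
    esym (x ∷ xs) (length xs ∸ j) ∎
    where
    n∸j≡suc : length xs ∸ j ≡ suc (length xs ∸ suc j)
    n∸j≡suc = ℕP.+-∸-assoc 1 j<n

  shiftedProduct-esym : ∀ xs k →
    shiftedProduct xs k ≡ ∑ (suc (length xs)) (λ j → esym xs (length xs ∸ j) * k ^ℚ j)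
  shiftedProduct-esym xs k =
    trans (sym (shiftedProduct-expansion xs k (suc (length xs)) ℕP.≤-refl))
          (∑-cong-< (suc (length xs)) (λ j j<sn → cong (_* k ^ℚ j) (coeff≡esym xs j (ℕP.≤-pred j<sn))))

  shiftedProduct-++ : ∀ xs ys k → shiftedProduct (xs ++ ys) k ≡ shiftedProduct xs k * shiftedProduct ys k
  shiftedProduct-++ [] ys k = sym (ℚP.*-identityˡ _)
  shiftedProduct-++ (x ∷ xs) ys k =
    trans (cong ((k + x) *_) (shiftedProduct-++ xs ys k)) (sym (ℚP.*-assoc (k + x) _ _))

  length-oneTo : ∀ m → length (oneTo m) ≡ m
  length-oneTo m = trans (LP.length-map _ (upTo m)) (LP.length-upTo m)

  oneTo-snoc : ∀ m → oneTo (suc m) ≡ oneTo m ++ (ℕ→ℚ (suc m) ∷ [])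
  oneTo-snoc m = trans (cong (map (λ i → ℕ→ℚ (suc i))) (sym (LP.upTo-∷ʳ m)))
                       (LP.map-++ (λ i → ℕ→ℚ (suc i)) (upTo m) (m ∷ []))

  shiftedProduct-oneTo : ∀ K m → shiftedProduct (oneTo m) (ℕ→ℚ K) ≡ ℕ→ℚ (((K ℕ.+ m) C m) ℕ.* m !)
  shiftedProduct-oneTo K zero = cong (λ n → ℕ→ℚ ((n C 0) ℕ.* 1)) (sym (ℕP.+-identityʳ K))
  shiftedProduct-oneTo K (suc m) = begin
    shiftedProduct (oneTo (suc m)) (ℕ→ℚ K)
      ≡⟨ cong (λ z → shiftedProduct z (ℕ→ℚ K)) (oneTo-snoc m) ⟩
    shiftedProduct (oneTo m ++ (ℕ→ℚ (suc m) ∷ [])) (ℕ→ℚ K)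
      ≡⟨ shiftedProduct-++ (oneTo m) _ (ℕ→ℚ K) ⟩
    shiftedProduct (oneTo m) (ℕ→ℚ K) * ((ℕ→ℚ K + ℕ→ℚ (suc m)) * 1ℚ)
      ≡⟨ cong₂ _*_ (shiftedProduct-oneTo K m) (trans (ℚP.*-identityʳ _) (sym (ℕ→ℚ-+ K (suc m)))) ⟩
    ℕ→ℚ (((K ℕ.+ m) C m) ℕ.* m !) * ℕ→ℚ (K ℕ.+ suc m)
      ≡⟨ sym (ℕ→ℚ-* (((K ℕ.+ m) C m) ℕ.* m !) (K ℕ.+ suc m)) ⟩
    ℕ→ℚ (((K ℕ.+ m) C m) ℕ.* m ! ℕ.* (K ℕ.+ suc m))
      ≡⟨ cong ℕ→ℚ (sym (rising-factorial-step K m)) ⟩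
    ℕ→ℚ (((K ℕ.+ suc m) C suc m) ℕ.* (suc m) !) ∎

module SnakeFormula where
  -- The right-hand side of Theorem 3.8 equals ∑_{s=0}^{t} C(s+a', a')·C(s+b', b')
  -- for a = a'+1, b = b'+1.  For any list xs of length n, the polynomial
  --   ∑_{i} ( ∑_{j} (-1)^{j+1-i} B_{j+1-i} e_{n-j}(xs) C(j+1,i)/(j+1) ) t^i
  -- is ∑_{k=1}^{t} ∏_{x ∈ xs} (k + x): exchange the sums, apply Faulhaber's
  -- formula for each j, and recombine the e_{n-j}(xs) k^j into the product.
  -- With xs = 1,…,a',1,…,b' the product is C(k+a',a') a'! · C(k+b',b') b'!.
  open import Defs
  open Casts
  open FiniteSums
  open Powers using (Cℚ; sign)
  open Faulhaber using (faulhaberPoly; faulhaber)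
  open SymmetricProducts
  open import Data.Nat as ℕ using (ℕ; suc; _∸_; s≤s; _!)
  import Data.Nat.Properties as ℕP
  open import Data.Nat.Properties using (_!*_!≢0)
  open import Data.Nat.Combinatorics using (_C_; nCn≡1; k>n⇒nCk≡0)
  open import Data.Integer using (+_)
  open import Data.Rational as ℚ using (ℚ; 0ℚ; 1ℚ; _+_; _*_)
  import Data.Rational.Properties as ℚP
  open import Data.List as List using (List; _++_; length)
  import Data.List.Properties as LP
  open import Relation.Binary.PropositionalEquality
  open import Data.Rational.Solver using (module +-*-Solver)
  open +-*-Solver
  open ≡-Reasoning

  summand : ℕ → List ℚ → ℕ → ℕ → ℚ
  summand n xs i j =
    sign (suc j ∸ i) * (bernoulli (suc j ∸ i) * esym xs (n ∸ j)) * 1/suc j * ℕ→ℚ (suc j C i)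

  -- The summands with j < i-1 vanish, so the coefficient is a full sum over j ≤ n.
  coefficient-full-sum : ∀ n xs i' → i' ℕ.≤ n →
    Σ[ i' ⋯ n ] (summand n xs (suc i')) ≡ ∑ (suc n) (summand n xs (suc i'))
  coefficient-full-sum n xs i' i'≤n = sym (begin
    ∑ (suc n) f
      ≡⟨ cong (λ z → ∑ z f) (sym (ℕP.m+[n∸m]≡n (ℕP.m≤n⇒m≤1+n i'≤n))) ⟩
    ∑ (i' ℕ.+ (suc n ∸ i')) f
      ≡⟨ ∑-split i' (suc n ∸ i') f ⟩
    ∑ i' f + ∑ (suc n ∸ i') (λ k → f (i' ℕ.+ k))
      ≡⟨ cong (_+ ∑ (suc n ∸ i') (λ k → f (i' ℕ.+ k))) (∑-zero i' below) ⟩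
    0ℚ + ∑ (suc n ∸ i') (λ k → f (i' ℕ.+ k))
      ≡⟨ trans (ℚP.+-identityˡ _) (sym (Σ[⋯]≡∑ i' n f)) ⟩
    Σ[ i' ⋯ n ] f ∎)
    where
    f : ℕ → ℚ
    f = summand n xs (suc i')
    below : ∀ j → j ℕ.< i' → f j ≡ 0ℚ
    below j j<i' = trans (cong (λ z → weight j * ℕ→ℚ z) (k>n⇒nCk≡0 (s≤s j<i'))) (ℚP.*-zeroʳ (weight j))
      where
      weight : ℕ → ℚ
      weight j = sign (j ∸ i') * (bernoulli (j ∸ i') * esym xs (n ∸ j)) * 1/suc j

  summands-in-j : ∀ n xs j x → j ℕ.≤ n →
    ∑ (suc n) (λ i' → summand n xs (suc i') j * x ^ℚ suc i')
      ≡ esym xs (n ∸ j) * 1/suc j * faulhaberPoly j x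
  summands-in-j n xs j x j≤n = begin
    ∑ (suc n) g
      ≡⟨ cong (λ z → ∑ z g) (sym (ℕP.m+[n∸m]≡n (s≤s j≤n))) ⟩
    ∑ (suc j ℕ.+ (suc n ∸ suc j)) g
      ≡⟨ ∑-truncate (suc j) (suc n ∸ suc j) g above ⟩
    ∑ (suc j) g
      ≡⟨ ∑-cong (suc j) (λ i → solve 6 (λ s b e d c p → s :* (b :* e) :* d :* c :* p := e :* d :* (s :* c :* b :* p)) refl
                                        (sign (j ∸ i)) (bernoulli (j ∸ i)) e (1/suc j) (Cℚ (suc j) (suc i)) (x ^ℚ suc i)) ⟩
    ∑ (suc j) (λ i → e * 1/suc j * (sign (j ∸ i) * Cℚ (suc j) (suc i) * bernoulli (j ∸ i) * x ^ℚ suc i))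
      ≡⟨ sym (∑-*ˡ (suc j) (e * 1/suc j)
                (λ i → sign (j ∸ i) * Cℚ (suc j) (suc i) * bernoulli (j ∸ i) * x ^ℚ suc i)) ⟩
    e * 1/suc j * faulhaberPoly j x ∎
    where
    e : ℚ
    e = esym xs (n ∸ j)
    g : ℕ → ℚ
    g = λ i' → summand n xs (suc i') j * x ^ℚ suc i'
    above : ∀ i → g (suc j ℕ.+ i) ≡ 0ℚ
    above i = trans (cong (λ z → w * ℕ→ℚ z * p) (k>n⇒nCk≡0 (s≤s (s≤s (ℕP.m≤m+n j i)))))
                    (solve 2 (λ a b → a :* con 0ℚ :* b := con 0ℚ) refl w p)
      where
      w : ℚ
      w = sign (suc j ∸ suc (suc j ℕ.+ i)) * (bernoulli (suc j ∸ suc (suc j ℕ.+ i)) * e) * 1/suc j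
      p : ℚ
      p = x ^ℚ suc (suc j ℕ.+ i)

  esym-power-sum : ∀ n xs j t →
    esym xs (n ∸ j) * 1/suc j * faulhaberPoly j (ℕ→ℚ t)
      ≡ ∑ t (λ k → esym xs (n ∸ j) * ℕ→ℚ (suc k) ^ℚ j)
  esym-power-sum n xs j t = begin
    e * 1/suc j * faulhaberPoly j (ℕ→ℚ t)
      ≡⟨ cong (e * 1/suc j *_) (sym (faulhaber j t)) ⟩
    e * 1/suc j * (ℕ→ℚ (suc j) * P)
      ≡⟨ solve 4 (λ e d n s → e :* d :* (n :* s) := e :* s :* (d :* n)) refl e (1/suc j) (ℕ→ℚ (suc j)) P ⟩
    e * P * (1/suc j * ℕ→ℚ (suc j))
      ≡⟨ trans (cong (e * P *_) (1/suc-inverse j)) (ℚP.*-identityʳ _) ⟩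
    e * P
      ≡⟨ ∑-*ˡ t e (λ k → ℕ→ℚ (suc k) ^ℚ j) ⟩
    ∑ t (λ k → e * ℕ→ℚ (suc k) ^ℚ j) ∎
    where
    e : ℚ
    e = esym xs (n ∸ j)
    P : ℚ
    P = ∑ t (λ k → ℕ→ℚ (suc k) ^ℚ j)

  polynomial-as-product-sum : ∀ n xs t → length xs ≡ n →
    ∑ (suc n) (λ i' → Σ[ i' ⋯ n ] (summand n xs (suc i')) * ℕ→ℚ t ^ℚ suc i')
      ≡ ∑ t (λ k → shiftedProduct xs (ℕ→ℚ (suc k)))
  polynomial-as-product-sum n xs t refl = begin
    ∑ (suc n) (λ i' → Σ[ i' ⋯ n ] (summand n xs (suc i')) * x ^ℚ suc i')
      ≡⟨ ∑-cong-< (suc n) (λ i' i'<sn → trans (cong (_* x ^ℚ suc i') (coefficient-full-sum n xs i' (ℕP.≤-pred i'<sn)))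
                                               (∑-*ʳ (suc n) (x ^ℚ suc i') (summand n xs (suc i')))) ⟩
    ∑ (suc n) (λ i' → ∑ (suc n) (λ j → summand n xs (suc i') j * x ^ℚ suc i'))
      ≡⟨ ∑-swap (suc n) (suc n) (λ i' j → summand n xs (suc i') j * x ^ℚ suc i') ⟩
    ∑ (suc n) (λ j → ∑ (suc n) (λ i' → summand n xs (suc i') j * x ^ℚ suc i'))
      ≡⟨ ∑-cong-< (suc n) (λ j j<sn → trans (summands-in-j n xs j x (ℕP.≤-pred j<sn)) (esym-power-sum n xs j t)) ⟩
    ∑ (suc n) (λ j → ∑ t (λ k → esym xs (n ∸ j) * ℕ→ℚ (suc k) ^ℚ j))
      ≡⟨ ∑-swap (suc n) t (λ j k → esym xs (n ∸ j) * ℕ→ℚ (suc k) ^ℚ j) ⟩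
    ∑ t (λ k → ∑ (suc n) (λ j → esym xs (n ∸ j) * ℕ→ℚ (suc k) ^ℚ j))
      ≡⟨ ∑-cong t (λ k → sym (shiftedProduct-esym xs (ℕ→ℚ (suc k)))) ⟩
    ∑ t (λ k → shiftedProduct xs (ℕ→ℚ (suc k))) ∎
    where
    x : ℚ
    x = ℕ→ℚ t

  -- The number of lattice points of level s (see LatticePoints), as a rational.
  levelCount : ℕ → ℕ → ℕ → ℚ
  levelCount a' b' s = ℕ→ℚ (((s ℕ.+ a') C a') ℕ.* ((s ℕ.+ b') C b'))

  normalised-product : ∀ a' b' k .{{_ : ℕ.NonZero (a' ! ℕ.* b' !)}} →
    ((+ 1) ℚ./ (a' ! ℕ.* b' !)) * shiftedProduct (oneTo a' ++ oneTo b') (ℕ→ℚ k) ≡ levelCount a' b' k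
  normalised-product a' b' k = begin
    iv * shiftedProduct (oneTo a' ++ oneTo b') (ℕ→ℚ k)
      ≡⟨ cong (iv *_) (shiftedProduct-++ (oneTo a') (oneTo b') _) ⟩
    iv * (shiftedProduct (oneTo a') (ℕ→ℚ k) * shiftedProduct (oneTo b') (ℕ→ℚ k))
      ≡⟨ cong₂ (λ u v → iv * (u * v)) (shiftedProduct-oneTo k a') (shiftedProduct-oneTo k b') ⟩
    iv * (ℕ→ℚ (A ℕ.* a' !) * ℕ→ℚ (B ℕ.* b' !))
      ≡⟨ cong₂ (λ u v → iv * (u * v)) (ℕ→ℚ-* A (a' !)) (ℕ→ℚ-* B (b' !)) ⟩
    iv * (ℕ→ℚ A * ℕ→ℚ (a' !) * (ℕ→ℚ B * ℕ→ℚ (b' !)))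
      ≡⟨ solve 5 (λ i X a Y b → i :* (X :* a :* (Y :* b)) := X :* Y :* (i :* (a :* b))) refl
           iv (ℕ→ℚ A) (ℕ→ℚ (a' !)) (ℕ→ℚ B) (ℕ→ℚ (b' !)) ⟩
    ℕ→ℚ A * ℕ→ℚ B * (iv * (ℕ→ℚ (a' !) * ℕ→ℚ (b' !)))
      ≡⟨ cong₂ (λ u v → u * (iv * v)) (sym (ℕ→ℚ-* A B)) (sym (ℕ→ℚ-* (a' !) (b' !))) ⟩
    levelCount a' b' k * (iv * ℕ→ℚ (a' ! ℕ.* b' !))
      ≡⟨ trans (cong (levelCount a' b' k *_) (1/-inverse (a' ! ℕ.* b' !))) (ℚP.*-identityʳ _) ⟩
    levelCount a' b' k ∎
    where
    iv : ℚ
    iv = (+ 1) ℚ./ (a' ! ℕ.* b' !)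
    A : ℕ
    A = (k ℕ.+ a') C a'
    B : ℕ
    B = (k ℕ.+ b') C b'

  snake-formula-as-sum : ∀ a' b' t →
    snakeEhrhartFormula (suc a') (suc b') t ≡ ∑ (suc t) (levelCount a' b')
  snake-formula-as-sum a' b' t = begin
    snakeEhrhartFormula (suc a') (suc b') t
      ≡⟨ cong (λ z → 1ℚ + iv * z) (Σ[⋯]≡∑ 1 (suc a' ℕ.+ suc b' ∸ 1) _) ⟩
    1ℚ + iv * ∑ (suc a' ℕ.+ suc b' ∸ 1) coefficientTerm
      ≡⟨ cong (λ z → 1ℚ + iv * ∑ z coefficientTerm) degree ⟩
    1ℚ + iv * ∑ (suc n) coefficientTerm
      ≡⟨ cong (λ z → 1ℚ + iv * z) (polynomial-as-product-sum n xs t length-xs) ⟩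
    1ℚ + iv * ∑ t (λ k → shiftedProduct xs (ℕ→ℚ (suc k)))
      ≡⟨ cong (λ z → 1ℚ + z) (trans (∑-*ˡ t iv _) (∑-cong t (λ k → normalised-product a' b' (suc k)))) ⟩
    1ℚ + ∑ t (λ k → levelCount a' b' (suc k))
      ≡⟨ cong (_+ ∑ t (λ k → levelCount a' b' (suc k)))
              (sym (cong ℕ→ℚ (cong₂ ℕ._*_ (nCn≡1 a') (nCn≡1 b')))) ⟩
    ∑ (suc t) (levelCount a' b') ∎
    where
    instance
      factorials≢0 : ℕ.NonZero (a' ! ℕ.* b' !)
      factorials≢0 = a' !* b' !≢0
    iv : ℚ
    iv = (+ 1) ℚ./ (a' ! ℕ.* b' !)
    xs : List ℚ
    xs = oneTo a' ++ oneTo b'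
    n : ℕ
    n = suc a' ℕ.+ suc b' ∸ 2
    coefficientTerm : ℕ → ℚ
    coefficientTerm = λ i' → Σ[ i' ⋯ n ] (summand n xs (suc i')) * ℕ→ℚ t ^ℚ suc i'
    degree : suc a' ℕ.+ suc b' ∸ 1 ≡ suc n
    degree = trans (ℕP.+-suc a' b') (cong suc (cong (_∸ 1) (sym (ℕP.+-suc a' b'))))
    length-xs : length xs ≡ n
    length-xs = trans (LP.length-++ (oneTo a'))
      (trans (cong₂ ℕ._+_ (length-oneTo a') (length-oneTo b')) (cong (_∸ 1) (sym (ℕP.+-suc a' b'))))

module LatticePaths where
  open import Defs
  open import Data.Nat as ℕ
  open import Data.Nat.Properties
  import Data.List.Properties as LP
  open import Data.Bool using (Bool; true; false)
  open import Data.List as List using (List; []; _∷_; _++_; length; replicate)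
  open import Relation.Binary.PropositionalEquality
  open import Data.Product using (_,_)

  east : List Bool → ℕ
  east [] = 0
  east (true ∷ P) = east P
  east (false ∷ P) = suc (east P)

  length≡north+east : ∀ P → length P ≡ north P + east P
  length≡north+east [] = refl
  length≡north+east (true ∷ P) = cong suc (length≡north+east P)
  length≡north+east (false ∷ P) = trans (cong suc (length≡north+east P)) (sym (+-suc (north P) (east P)))

  north-++ : ∀ P Q → north (P ++ Q) ≡ north P + north Q
  north-++ [] Q = refl
  north-++ (true ∷ P) Q = cong suc (north-++ P Q)
  north-++ (false ∷ P) Q = north-++ P Q

  north-replicate-false : ∀ m → north (replicate m false) ≡ 0
  north-replicate-false zero = refl
  north-replicate-false (suc m) = north-replicate-false m

  north-replicate-true : ∀ m → north (replicate m true) ≡ m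
  north-replicate-true zero = refl
  north-replicate-true (suc m) = cong suc (north-replicate-true m)

  northPrefix-++ : ∀ k P Q → northPrefix k (P ++ Q) ≡ northPrefix k P + northPrefix (k ∸ length P) Q
  northPrefix-++ zero P Q = cong (λ z → northPrefix z Q) (sym (0∸n≡0 (length P)))
  northPrefix-++ (suc k) [] Q = refl
  northPrefix-++ (suc k) (true ∷ P) Q = cong suc (northPrefix-++ k P Q)
  northPrefix-++ (suc k) (false ∷ P) Q = northPrefix-++ k P Q

  northPrefix-replicate-false : ∀ k m → northPrefix k (replicate m false) ≡ 0
  northPrefix-replicate-false zero m = refl
  northPrefix-replicate-false (suc k) zero = refl
  northPrefix-replicate-false (suc k) (suc m) = northPrefix-replicate-false k m

  northPrefix-replicate-true : ∀ k m → northPrefix k (replicate m true) ≡ k ⊓ m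
  northPrefix-replicate-true zero m = refl
  northPrefix-replicate-true (suc k) zero = refl
  northPrefix-replicate-true (suc k) (suc m) = cong suc (northPrefix-replicate-true k m)

  northPrefix≤north : ∀ k P → northPrefix k P ≤ north P
  northPrefix≤north zero P = z≤n
  northPrefix≤north (suc k) [] = z≤n
  northPrefix≤north (suc k) (true ∷ P) = s≤s (northPrefix≤north k P)
  northPrefix≤north (suc k) (false ∷ P) = northPrefix≤north k P

  northPrefix≤length : ∀ k P → northPrefix k P ≤ k
  northPrefix≤length zero P = z≤n
  northPrefix≤length (suc k) [] = z≤n
  northPrefix≤length (suc k) (true ∷ P) = s≤s (northPrefix≤length k P)
  northPrefix≤length (suc k) (false ∷ P) = m≤n⇒m≤1+n (northPrefix≤length k P)

  northPrefix-mono : ∀ {k k'} P → k ≤ k' → northPrefix k P ≤ northPrefix k' P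
  northPrefix-mono P z≤n = z≤n
  northPrefix-mono [] (s≤s _) = z≤n
  northPrefix-mono (true ∷ P) (s≤s k≤k') = s≤s (northPrefix-mono P k≤k')
  northPrefix-mono (false ∷ P) (s≤s k≤k') = northPrefix-mono P k≤k'

  northPrefix-+ : ∀ k d P → northPrefix (k + d) P ≤ northPrefix k P + d
  northPrefix-+ zero d P = northPrefix≤length d P
  northPrefix-+ (suc k) d [] = z≤n
  northPrefix-+ (suc k) d (true ∷ P) = s≤s (northPrefix-+ k d P)
  northPrefix-+ (suc k) d (false ∷ P) = northPrefix-+ k d P

  -- Among the first k steps at most (east P) are east steps.
  northPrefix-lower : ∀ k P → k ≤ length P → k ∸ east P ≤ northPrefix k P
  northPrefix-lower zero P _ = ≤-reflexive (0∸n≡0 (east P))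
  northPrefix-lower (suc k) (true ∷ P) (s≤s k≤n) =
    ≤-trans (∸-suc-≤ k (east P)) (s≤s (northPrefix-lower k P k≤n))
    where
    ∸-suc-≤ : ∀ k e → suc k ∸ e ≤ suc (k ∸ e)
    ∸-suc-≤ k zero = ≤-refl
    ∸-suc-≤ zero (suc e) = ≤-trans (≤-reflexive (0∸n≡0 e)) z≤n
    ∸-suc-≤ (suc k) (suc e) = ∸-suc-≤ k e
  northPrefix-lower (suc k) (false ∷ P) (s≤s k≤n) = northPrefix-lower k P k≤n

  module Snake (a' b' : ℕ) where
    a : ℕ
    a = suc a'
    b : ℕ
    b = suc b'

    -- U = N E^{a-1} N^{b-1} E rises to height 1 at once, then follows the column.
    northPrefix-snakeU : ∀ k → northPrefix (suc k) (snakeU a b) ≡ suc ((k ∸ a') ⊓ b')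
    northPrefix-snakeU k = cong suc (begin
      northPrefix k (replicate a' false ++ (replicate b' true ++ (false ∷ [])))
        ≡⟨ northPrefix-++ k (replicate a' false) _ ⟩
      northPrefix k (replicate a' false) + northPrefix (k ∸ length (replicate a' false)) (replicate b' true ++ (false ∷ []))
        ≡⟨ cong₂ (λ u v → u + northPrefix (k ∸ v) (replicate b' true ++ (false ∷ [])))
                 (northPrefix-replicate-false k a') (LP.length-replicate a') ⟩
      northPrefix (k ∸ a') (replicate b' true ++ (false ∷ []))
        ≡⟨ northPrefix-++ (k ∸ a') (replicate b' true) _ ⟩
      northPrefix (k ∸ a') (replicate b' true) + northPrefix (k ∸ a' ∸ length (replicate b' true)) (false ∷ [])
        ≡⟨ cong₂ _+_ (northPrefix-replicate-true (k ∸ a') b')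
                     (northPrefix-replicate-false (k ∸ a' ∸ length (replicate b' true)) 1) ⟩
      (k ∸ a') ⊓ b' + 0
        ≡⟨ +-identityʳ _ ⟩
      (k ∸ a') ⊓ b' ∎)
      where open ≡-Reasoning

    northPrefix-snakeL : ∀ k → northPrefix k (snakeL a b) ≡ (k ∸ a) ⊓ b
    northPrefix-snakeL k =
      trans (northPrefix-++ k (replicate a false) (replicate b true))
      (trans (cong₂ (λ u v → u + northPrefix (k ∸ v) (replicate b true))
                    (northPrefix-replicate-false k a) (LP.length-replicate a))
             (northPrefix-replicate-true (k ∸ a) b))

    length-snakeL : length (snakeL a b) ≡ a + b
    length-snakeL = trans (LP.length-++ (replicate a false)) (cong₂ _+_ (LP.length-replicate a) (LP.length-replicate b))

    snakeBasis⇐ : ∀ P → length P ≡ a + b → north P ≡ b → northPrefix a P ≤ 1 → IsSnakeBasis a b P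
    snakeBasis⇐ P length≡ north≡ prefix≤1 = (length≡ , north≡) , belowU , aboveL
      where
      belowU : NeverAbove P (snakeU a b)
      belowU zero _ = z≤n
      belowU (suc k) _ rewrite northPrefix-snakeU k = ⊓-glb within-row within-column
        where
        -- after the first a steps at most one north step, then at most one per step
        within-row : northPrefix (suc k) P ≤ suc (k ∸ a')
        within-row = ≤-trans (northPrefix-mono P (s≤s (m≤n+m∸n k a')))
                             (≤-trans (northPrefix-+ a (k ∸ a') P) (+-monoˡ-≤ (k ∸ a') prefix≤1))
        within-column : northPrefix (suc k) P ≤ suc b'
        within-column = subst (northPrefix (suc k) P ≤_) north≡ (northPrefix≤north (suc k) P)
      east≡a : east P ≡ a
      east≡a = +-cancelˡ-≡ b _ _
        (trans (sym (trans (length≡north+east P) (cong (_+ east P) north≡))) (trans length≡ (+-comm a b)))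
      aboveL : NeverAbove (snakeL a b) P
      aboveL k k≤n rewrite northPrefix-snakeL k = ≤-trans (m⊓n≤m (k ∸ a) b)
        (subst (λ e → k ∸ e ≤ northPrefix k P) east≡a
          (northPrefix-lower k P (subst (k ≤_) (trans length-snakeL (sym length≡)) k≤n)))

    snakeBasis⇒ : ∀ {P} → IsSnakeBasis a b P → northPrefix a P ≤ 1
    snakeBasis⇒ {P} ((length≡ , _) , belowU , _) =
      subst (northPrefix a P ≤_) (trans (northPrefix-snakeU a') (cong (λ z → suc (z ⊓ b')) (n∸n≡0 a')))
            (belowU a (subst (a ≤_) (sym length≡) (m≤m+n a b)))

module Compositions where
  open import Defs using (ℕ→ℚ)
  open Casts using (ℕ→ℚ-+)
  open FiniteSums using (∑; ∑-snoc)
  open SnakeFormula using (levelCount)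
  open import Data.Nat as ℕ
  open import Data.Nat.Properties
  open import Data.Nat.Combinatorics using (_C_; nCn≡1; nCk+nC[k+1]≡[n+1]C[k+1])
  open import Data.List as List using (List; []; _∷_; _++_; length; map; cartesianProduct)
  open import Data.Nat.ListAction using (sum)
  import Data.List.Properties as LP
  open import Data.List.Membership.Propositional using (_∈_)
  open import Data.List.Membership.Propositional.Properties
  open import Data.List.Relation.Unary.Any using (here)
  open import Data.List.Relation.Unary.Unique.Propositional using (Unique)
  import Data.List.Relation.Unary.Unique.Propositional.Properties as Unique
  open import Data.List.Relation.Unary.AllPairs using ([]; _∷_)
  open import Data.List.Relation.Unary.All using ([])
  open import Data.Product using (_×_; _,_; ∃)
  open import Data.Sum using (inj₁; inj₂)
  open import Data.Empty using (⊥)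
  import Data.Rational as ℚ
  import Data.Rational.Properties as ℚP
  open import Relation.Binary.PropositionalEquality

  IsComposition : ℕ → ℕ → List ℕ → Set
  IsComposition m s u = length u ≡ m × sum u ≡ s

  bump : List ℕ → List ℕ
  bump [] = []
  bump (x ∷ u) = suc x ∷ u

  -- Either the first part is 0, or it is positive and decreasing it gives a
  -- composition of s - 1.
  compositions : ℕ → ℕ → List (List ℕ)
  compositions zero zero = [] ∷ []
  compositions zero (suc s) = []
  compositions (suc m) zero = map (0 ∷_) (compositions m zero)
  compositions (suc m) (suc s) = map (0 ∷_) (compositions m (suc s)) ++ map bump (compositions (suc m) s)

  private
    sound-0∷ : ∀ {m s u} → (∀ {w} → w ∈ compositions m s → IsComposition m s w) →
               u ∈ map (0 ∷_) (compositions m s) → IsComposition (suc m) s u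
    sound-0∷ sound u∈ with ∈-map⁻ (0 ∷_) u∈
    ... | w , w∈ , refl = let (length≡ , sum≡) = sound w∈ in cong suc length≡ , sum≡

    sound-bump : ∀ {m s u} → (∀ {w} → w ∈ compositions (suc m) s → IsComposition (suc m) s w) →
                 u ∈ map bump (compositions (suc m) s) → IsComposition (suc m) (suc s) u
    sound-bump sound u∈ with ∈-map⁻ bump u∈
    ... | x ∷ w , w∈ , refl = let (length≡ , sum≡) = sound w∈ in length≡ , cong suc sum≡
    ... | [] , w∈ , refl with sound w∈
    ...   | () , _

  compositions-sound : ∀ m s {u} → u ∈ compositions m s → IsComposition m s u
  compositions-sound zero zero (here refl) = refl , refl
  compositions-sound (suc m) zero u∈ = sound-0∷ (compositions-sound m zero) u∈
  compositions-sound (suc m) (suc s) u∈ with ∈-++⁻ (map (0 ∷_) (compositions m (suc s))) u∈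
  ... | inj₁ u∈₁ = sound-0∷ (compositions-sound m (suc s)) u∈₁
  ... | inj₂ u∈₂ = sound-bump (compositions-sound (suc m) s) u∈₂

  compositions-complete : ∀ m s u → IsComposition m s u → u ∈ compositions m s
  compositions-complete zero zero [] _ = here refl
  compositions-complete (suc m) zero (x ∷ u) (l , e) with m+n≡0⇒m≡0 x {sum u} e
  ... | refl = ∈-map⁺ (0 ∷_) (compositions-complete m zero u (suc-injective l , e))
  compositions-complete (suc m) (suc s) (zero ∷ u) (l , e) =
    ∈-++⁺ˡ (∈-map⁺ (0 ∷_) (compositions-complete m (suc s) u (suc-injective l , e)))
  compositions-complete (suc m) (suc s) (suc x ∷ u) (l , e) =
    ∈-++⁺ʳ (map (0 ∷_) (compositions m (suc s)))
           (∈-map⁺ bump (compositions-complete (suc m) s (x ∷ u) (l , suc-injective e)))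

  compositions-unique : ∀ m s → Unique (compositions m s)
  compositions-unique zero zero = [] ∷ []
  compositions-unique zero (suc s) = []
  compositions-unique (suc m) zero = Unique.map⁺ LP.∷-injectiveʳ (compositions-unique m zero)
  compositions-unique (suc m) (suc s) =
    Unique.++⁺ (Unique.map⁺ LP.∷-injectiveʳ (compositions-unique m (suc s)))
               (Unique.map⁺ bump-injective (compositions-unique (suc m) s)) disjoint
    where
    bump-injective : ∀ {u w} → bump u ≡ bump w → u ≡ w
    bump-injective {[]} {[]} _ = refl
    bump-injective {_ ∷ _} {_ ∷ _} refl = refl
    -- the first part is 0 on the left and positive on the right
    disjoint : ∀ {u} → u ∈ map (0 ∷_) (compositions m (suc s)) × u ∈ map bump (compositions (suc m) s) → ⊥
    disjoint (p , q) with ∈-map⁻ (0 ∷_) p | ∈-map⁻ bump q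
    ... | _ , _ , refl | w , w∈ , e with compositions-sound (suc m) s w∈
    ...   | l , _ with w | e
    ...     | _ ∷ _ | ()

  length-compositions : ∀ m s → length (compositions (suc m) s) ≡ (s + m) C m
  length-compositions m zero = trans (zero-sum (suc m)) (sym (nCn≡1 m))
    where
    zero-sum : ∀ m → length (compositions m 0) ≡ 1
    zero-sum zero = refl
    zero-sum (suc m) = trans (LP.length-map (0 ∷_) (compositions m 0)) (zero-sum m)
  length-compositions zero (suc s) =
    trans (LP.length-map bump (compositions 1 s))
    (trans (length-compositions zero s) (trans (cong (_C 0) (+-identityʳ s)) (cong (_C 0) (sym (+-identityʳ (suc s))))))
  length-compositions (suc m) (suc s) = begin
    length (map (0 ∷_) (compositions (suc m) (suc s)) ++ map bump (compositions (suc (suc m)) s))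
      ≡⟨ LP.length-++ (map (0 ∷_) (compositions (suc m) (suc s))) ⟩
    length (map (0 ∷_) (compositions (suc m) (suc s))) + length (map bump (compositions (suc (suc m)) s))
      ≡⟨ cong₂ _+_ (LP.length-map (0 ∷_) (compositions (suc m) (suc s)))
                   (LP.length-map bump (compositions (suc (suc m)) s)) ⟩
    length (compositions (suc m) (suc s)) + length (compositions (suc (suc m)) s)
      ≡⟨ cong₂ _+_ (length-compositions m (suc s)) (length-compositions (suc m) s) ⟩
    ((suc s + m) C m) + ((s + suc m) C suc m)
      ≡⟨ cong (λ z → (z C m) + ((s + suc m) C suc m)) (sym (+-suc s m)) ⟩
    ((s + suc m) C m) + ((s + suc m) C suc m)
      ≡⟨ nCk+nC[k+1]≡[n+1]C[k+1] (s + suc m) m ⟩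
    (suc s + suc m) C suc m ∎
    where open ≡-Reasoning

  module Pairs (a b : ℕ) where

    level : ℕ → List (List ℕ × List ℕ)
    level s = cartesianProduct (compositions a s) (compositions b s)

    levelsUpTo : ℕ → List (List ℕ × List ℕ)
    levelsUpTo zero = level 0
    levelsUpTo (suc t) = levelsUpTo t ++ level (suc t)

    IsPairAt : ℕ → List ℕ × List ℕ → Set
    IsPairAt s (u , v) = IsComposition a s u × IsComposition b s v

    level-sound : ∀ s {p} → p ∈ level s → IsPairAt s p
    level-sound s p∈ = let (u∈ , v∈) = ∈-cartesianProduct⁻ (compositions a s) (compositions b s) p∈ in
      compositions-sound a s u∈ , compositions-sound b s v∈

    level-complete : ∀ s {u v} → IsPairAt s (u , v) → (u , v) ∈ level s
    level-complete s (u-comp , v-comp) =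
      ∈-cartesianProduct⁺ (compositions-complete a s _ u-comp) (compositions-complete b s _ v-comp)

    level-unique : ∀ s → Unique (level s)
    level-unique s = Unique.cartesianProduct⁺ (compositions-unique a s) (compositions-unique b s)

    levelsUpTo-sound : ∀ t {p} → p ∈ levelsUpTo t → ∃ λ s → s ≤ t × IsPairAt s p
    levelsUpTo-sound zero p∈ = 0 , z≤n , level-sound 0 p∈
    levelsUpTo-sound (suc t) p∈ with ∈-++⁻ (levelsUpTo t) p∈
    ... | inj₁ p∈′ = let (s , s≤t , at) = levelsUpTo-sound t p∈′ in s , m≤n⇒m≤1+n s≤t , at
    ... | inj₂ p∈′ = suc t , ≤-refl , level-sound (suc t) p∈′

    levelsUpTo-complete : ∀ t s {p} → s ≤ t → IsPairAt s p → p ∈ levelsUpTo t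
    levelsUpTo-complete zero .zero z≤n at = level-complete 0 at
    levelsUpTo-complete (suc t) s s≤ at with m≤n⇒m<n∨m≡n s≤
    ... | inj₁ (s≤s s≤t) = ∈-++⁺ˡ (levelsUpTo-complete t s s≤t at)
    ... | inj₂ refl = ∈-++⁺ʳ (levelsUpTo t) (level-complete (suc t) at)

    levelsUpTo-unique : ∀ t → Unique (levelsUpTo t)
    levelsUpTo-unique zero = level-unique 0
    levelsUpTo-unique (suc t) = Unique.++⁺ (levelsUpTo-unique t) (level-unique (suc t)) disjoint
      where
      -- the level is determined by the sum of the first component
      disjoint : ∀ {p} → p ∈ levelsUpTo t × p ∈ level (suc t) → ⊥
      disjoint (p∈ , q∈) with levelsUpTo-sound t p∈ | level-sound (suc t) q∈
      ... | s , s≤t , ((_ , sum≡s) , _) | (_ , sum≡1+t) , _ = <⇒≢ (s≤s s≤t) (trans (sym sum≡s) sum≡1+t)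

  length-cartesianProduct : ∀ {A B : Set} (xs : List A) (ys : List B) →
    length (cartesianProduct xs ys) ≡ length xs * length ys
  length-cartesianProduct [] ys = refl
  length-cartesianProduct (x ∷ xs) ys =
    trans (LP.length-++ (map (x ,_) ys)) (cong₂ _+_ (LP.length-map (x ,_) ys) (length-cartesianProduct xs ys))

  module _ (a' b' : ℕ) where
    open Pairs (suc a') (suc b')

    length-level : ∀ s → length (level s) ≡ ((s + a') C a') * ((s + b') C b')
    length-level s = trans (length-cartesianProduct (compositions (suc a') s) (compositions (suc b') s))
                           (cong₂ _*_ (length-compositions a' s) (length-compositions b' s))

    length-levelsUpTo : ∀ t → ℕ→ℚ (length (levelsUpTo t)) ≡ ∑ (suc t) (levelCount a' b')
    length-levelsUpTo zero = trans (cong ℕ→ℚ (length-level 0)) (sym (ℚP.+-identityʳ (levelCount a' b' 0)))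
    length-levelsUpTo (suc t) =
      trans (cong ℕ→ℚ (LP.length-++ (levelsUpTo t)))
      (trans (ℕ→ℚ-+ (length (levelsUpTo t)) (length (level (suc t))))
      (trans (cong₂ ℚ._+_ (length-levelsUpTo t) (cong ℕ→ℚ (length-level (suc t))))
             (sym (∑-snoc (suc t) (levelCount a' b')))))

module PolytopeBounds where
  open import Defs
  open Casts
  open import Data.Nat as ℕ using (ℕ; zero; suc; _⊓_)
  import Data.Nat.Properties as ℕP
  open import Data.Bool using (Bool; true; false; if_then_else_)
  open import Data.Rational as ℚ using (ℚ; 0ℚ; _+_; _*_; _≤_)
  import Data.Rational.Properties as ℚP
  open import Data.List as List using (List; []; _∷_; length; map; replicate; zipWith; take)
  import Data.List.Properties as LP
  open import Data.List.Relation.Unary.All as All using (All; []; _∷_)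
  open import Data.Product using (_×_; _,_; proj₁; proj₂)
  open import Relation.Binary.PropositionalEquality
  open import Data.Rational.Solver using (module +-*-Solver)
  open +-*-Solver

  sum-zipWith : ∀ (xs ys : List ℚ) → length xs ≡ length ys → sum (zipWith _+_ xs ys) ≡ sum xs + sum ys
  sum-zipWith [] [] _ = sym (ℚP.+-identityˡ 0ℚ)
  sum-zipWith (x ∷ xs) (y ∷ ys) e = trans (cong (x + y +_) (sum-zipWith xs ys (ℕP.suc-injective e)))
    (solve 4 (λ x y a b → (x :+ y) :+ (a :+ b) := (x :+ a) :+ (y :+ b)) refl x y (sum xs) (sum ys))

  sum-replicate-0 : ∀ n → sum (replicate n 0ℚ) ≡ 0ℚ
  sum-replicate-0 zero = refl
  sum-replicate-0 (suc n) = trans (ℚP.+-identityˡ _) (sum-replicate-0 n)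

  sum-scaledIndicator : ∀ μ B → sum (scaledIndicator μ B) ≡ μ * ℕ→ℚ (north B)
  sum-scaledIndicator μ [] = sym (ℚP.*-zeroʳ μ)
  sum-scaledIndicator μ (true ∷ B) = trans (cong (μ +_) (sum-scaledIndicator μ B))
    (trans (solve 2 (λ c n → c :+ c :* n := c :* (con (ℕ→ℚ 1) :+ n)) refl μ (ℕ→ℚ (north B)))
           (cong (μ *_) (sym (ℕ→ℚ-suc (north B)))))
  sum-scaledIndicator μ (false ∷ B) = trans (cong (0ℚ +_) (sum-scaledIndicator μ B)) (ℚP.+-identityˡ _)

  length-scaledIndicator : ∀ μ B → length (scaledIndicator μ B) ≡ length B
  length-scaledIndicator μ B = LP.length-map _ B

  take-zipWith : ∀ k (xs ys : List ℚ) → take k (zipWith _+_ xs ys) ≡ zipWith _+_ (take k xs) (take k ys)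
  take-zipWith zero xs ys = refl
  take-zipWith (suc k) [] ys = refl
  take-zipWith (suc k) (x ∷ xs) [] = refl
  take-zipWith (suc k) (x ∷ xs) (y ∷ ys) = cong (x + y ∷_) (take-zipWith k xs ys)

  north-take : ∀ k B → north (take k B) ≡ northPrefix k B
  north-take zero B = refl
  north-take (suc k) [] = refl
  north-take (suc k) (true ∷ B) = cong suc (north-take k B)
  north-take (suc k) (false ∷ B) = north-take k B

  take-replicate : ∀ {A : Set} k n (x : A) → take k (replicate n x) ≡ replicate (k ⊓ n) x
  take-replicate zero n x = refl
  take-replicate (suc k) zero x = refl
  take-replicate (suc k) (suc n) x = cong (x ∷_) (take-replicate k n x)

  All-zipWith : ∀ {P Q R : ℚ → Set} {xs ys} → All P xs → All Q ys →
    (∀ {x y} → P x → Q y → R (x + y)) → All R (zipWith _+_ xs ys)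
  All-zipWith [] _ f = []
  All-zipWith (p ∷ ps) [] f = []
  All-zipWith (p ∷ ps) (q ∷ qs) f = f p q ∷ All-zipWith ps qs f

  Between0 : ℚ → ℚ → Set
  Between0 m q = (0ℚ ≤ q) × (q ≤ m)

  module _ (n : ℕ) (IsB : List Bool → Set) (length-basis : ∀ {B} → IsB B → length B ≡ n) where

    WeightedBases : List (ℚ × List Bool) → Set
    WeightedBases = All (λ p → (0ℚ ≤ proj₁ p) × IsB (proj₂ p))

    totalWeight : List (ℚ × List Bool) → ℚ
    totalWeight cs = sum (map proj₁ cs)

    combination-length : ∀ cs → WeightedBases cs → length (combination n cs) ≡ n
    combination-length [] _ = LP.length-replicate n
    combination-length ((μ , B) ∷ cs) ((_ , isB) ∷ ws) =
      trans (LP.length-zipWith _+_ (scaledIndicator μ B) (combination n cs))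
      (trans (cong₂ _⊓_ (trans (length-scaledIndicator μ B) (length-basis isB)) (combination-length cs ws))
             (ℕP.⊓-idem n))

    private
      same-length : ∀ μ B cs → IsB B → WeightedBases cs → length (scaledIndicator μ B) ≡ length (combination n cs)
      same-length μ B cs isB ws =
        trans (length-scaledIndicator μ B) (trans (length-basis isB) (sym (combination-length cs ws)))

    combination-sum : ∀ r → (∀ {B} → IsB B → north B ≡ r) →
      ∀ cs → WeightedBases cs → sum (combination n cs) ≡ ℕ→ℚ r * totalWeight cs
    combination-sum r rank [] _ = trans (sum-replicate-0 n) (sym (ℚP.*-zeroʳ (ℕ→ℚ r)))
    combination-sum r rank ((μ , B) ∷ cs) ((_ , isB) ∷ ws) =
      trans (sum-zipWith (scaledIndicator μ B) (combination n cs) (same-length μ B cs isB ws))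
      (trans (cong₂ _+_ (trans (sum-scaledIndicator μ B) (cong (λ z → μ * ℕ→ℚ z) (rank isB)))
                        (combination-sum r rank cs ws))
             (solve 3 (λ m b s → m :* b :+ b :* s := b :* (m :+ s)) refl μ (ℕ→ℚ r) (totalWeight cs)))

    combination-prefix : ∀ k → (∀ {B} → IsB B → northPrefix k B ℕ.≤ 1) →
      ∀ cs → WeightedBases cs → sum (take k (combination n cs)) ≤ totalWeight cs
    combination-prefix k meets-once [] _ =
      ℚP.≤-reflexive (trans (cong sum (take-replicate k n 0ℚ)) (sum-replicate-0 (k ⊓ n)))
    combination-prefix k meets-once ((μ , B) ∷ cs) ((μ≥0 , isB) ∷ ws) = begin
      sum (take k (zipWith _+_ (scaledIndicator μ B) (combination n cs)))
        ≡⟨ cong sum (take-zipWith k (scaledIndicator μ B) (combination n cs)) ⟩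
      sum (zipWith _+_ (take k (scaledIndicator μ B)) (take k (combination n cs)))
        ≡⟨ sum-zipWith (take k (scaledIndicator μ B)) (take k (combination n cs)) prefixes-same-length ⟩
      sum (take k (scaledIndicator μ B)) + sum (take k (combination n cs))
        ≡⟨ cong (_+ sum (take k (combination n cs))) head-sum ⟩
      μ * ℕ→ℚ (northPrefix k B) + sum (take k (combination n cs))
        ≤⟨ ℚP.+-mono-≤ head-bound (combination-prefix k meets-once cs ws) ⟩
      μ + totalWeight cs ∎
      where
      open ℚP.≤-Reasoning
      prefixes-same-length : length (take k (scaledIndicator μ B)) ≡ length (take k (combination n cs))
      prefixes-same-length =
        trans (LP.length-take k (scaledIndicator μ B))
        (trans (cong (k ⊓_) (same-length μ B cs isB ws)) (sym (LP.length-take k (combination n cs))))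
      head-sum : sum (take k (scaledIndicator μ B)) ≡ μ * ℕ→ℚ (northPrefix k B)
      head-sum = trans (cong sum (LP.take-map {f = λ b → if b then μ else 0ℚ} k B))
                       (trans (sum-scaledIndicator μ (take k B)) (cong (λ z → μ * ℕ→ℚ z) (north-take k B)))
      head-bound : μ * ℕ→ℚ (northPrefix k B) ≤ μ
      head-bound = ℚP.≤-trans (ℚP.*-monoˡ-≤-nonNeg μ {{ℚ.nonNegative μ≥0}} (ℕ→ℚ-mono-≤ (meets-once isB)))
                              (ℚP.≤-reflexive (ℚP.*-identityʳ μ))

    combination-bounds : ∀ cs → WeightedBases cs → All (Between0 (totalWeight cs)) (combination n cs)
    combination-bounds [] _ = zeros n
      where
      zeros : ∀ k → All (Between0 0ℚ) (replicate k 0ℚ)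
      zeros zero = []
      zeros (suc k) = (ℚP.≤-refl , ℚP.≤-refl) ∷ zeros k
    combination-bounds ((μ , B) ∷ cs) ((μ≥0 , _) ∷ ws) =
      All-zipWith (indicator-bounds B) (combination-bounds cs ws)
                  (λ (p₀ , p₁) (q₀ , q₁) → ℚP.+-mono-≤ p₀ q₀ , ℚP.+-mono-≤ p₁ q₁)
      where
      indicator-bounds : ∀ B → All (Between0 μ) (scaledIndicator μ B)
      indicator-bounds [] = []
      indicator-bounds (true ∷ B) = (μ≥0 , ℚP.≤-refl) ∷ indicator-bounds B
      indicator-bounds (false ∷ B) = (ℚP.≤-refl , μ≥0) ∷ indicator-bounds B

module HookDecomposition where
  -- Every pair (u, v) of compositions of a common s ≤ t into a and b parts
  -- gives the lattice point  u ++ (t - v)  of t·P_{S(a,b)}, by an explicit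
  -- decomposition: (t - s)·e_L for the lower path L = E^a N^b, plus one
  -- "hook" basis  e_k-row ++ (all-but-e_j)-column  for each unit of s.
  open import Defs hiding (sum)
  open Casts
  open LatticePaths
  open PolytopeBounds using (length-scaledIndicator)
  open Compositions using (IsComposition)
  open import Data.Nat as ℕ using (ℕ; zero; suc; _∸_; _<_; z≤n; s≤s)
  import Data.Nat.Properties as ℕP
  open import Data.Bool using (Bool; true; false)
  open import Data.Rational as ℚ using (ℚ; 0ℚ; 1ℚ; _+_)
  import Data.Rational.Properties as ℚP
  open import Data.List as List using (List; []; _∷_; _++_; length; map; replicate; zipWith)
  open import Data.Nat.ListAction using (sum)
  import Data.List.Properties as LP
  open import Data.List.Relation.Unary.All as All using (All; []; _∷_)
  open import Data.Product using (Σ; _×_; _,_)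
  open import Relation.Binary.PropositionalEquality

  unitWord : ℕ → ℕ → List Bool
  unitWord k zero = []
  unitWord zero (suc m) = true ∷ replicate m false
  unitWord (suc k) (suc m) = false ∷ unitWord k m

  counitWord : ℕ → ℕ → List Bool
  counitWord j zero = []
  counitWord zero (suc m) = false ∷ replicate m true
  counitWord (suc j) (suc m) = true ∷ counitWord j m

  incrementAt : ℕ → List ℕ → List ℕ
  incrementAt _ [] = []
  incrementAt zero (x ∷ u) = suc x ∷ u
  incrementAt (suc k) (x ∷ u) = x ∷ incrementAt k u

  length-unitWord : ∀ k m → length (unitWord k m) ≡ m
  length-unitWord k zero = refl
  length-unitWord zero (suc m) = cong suc (LP.length-replicate m)
  length-unitWord (suc k) (suc m) = cong suc (length-unitWord k m)

  length-counitWord : ∀ j m → length (counitWord j m) ≡ m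
  length-counitWord j zero = refl
  length-counitWord zero (suc m) = cong suc (LP.length-replicate m)
  length-counitWord (suc j) (suc m) = cong suc (length-counitWord j m)

  north-unitWord : ∀ k m → k < m → north (unitWord k m) ≡ 1
  north-unitWord zero (suc m) _ = cong suc (north-replicate-false m)
  north-unitWord (suc k) (suc m) (s≤s k<m) = north-unitWord k m k<m

  north-counitWord : ∀ j m → j < suc m → north (counitWord j (suc m)) ≡ m
  north-counitWord zero m _ = north-replicate-true m
  north-counitWord (suc j) (suc m) (s≤s j<m) = cong suc (north-counitWord j m j<m)

  decrement : ∀ u s → sum u ≡ suc s →
    Σ ℕ λ k → Σ (List ℕ) λ u' → k < length u' × u ≡ incrementAt k u' × sum u' ≡ s × length u' ≡ length u
  decrement (suc x ∷ u) s e = 0 , x ∷ u , s≤s z≤n , refl , ℕP.suc-injective e , refl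
  decrement (zero ∷ u) s e with decrement u s e
  ... | k , u' , k< , refl , sum≡ , length≡ = suc k , 0 ∷ u' , s≤s k< , refl , sum≡ , cong suc length≡

  entries≤sum : ∀ v → All (ℕ._≤ sum v) v
  entries≤sum [] = []
  entries≤sum (x ∷ v) =
    ℕP.m≤m+n x (sum v) ∷ All.map (λ p → ℕP.≤-trans p (ℕP.m≤n+m (sum v) x)) (entries≤sum v)

  sum≡0 : ∀ u → sum u ≡ 0 → u ≡ replicate (length u) 0
  sum≡0 [] _ = refl
  sum≡0 (x ∷ u) e with ℕP.m+n≡0⇒m≡0 x {sum u} e
  ... | refl = cong (0 ∷_) (sum≡0 u (ℕP.m+n≡0⇒n≡0 x {sum u} e))

  zipWith-0ˡ : ∀ xs → zipWith _+_ (replicate (length xs) 0ℚ) xs ≡ xs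
  zipWith-0ˡ [] = refl
  zipWith-0ˡ (x ∷ xs) = cong₂ _∷_ (ℚP.+-identityˡ x) (zipWith-0ˡ xs)

  zipWith-0ʳ : ∀ xs n → length xs ≡ n → zipWith _+_ xs (replicate n 0ℚ) ≡ xs
  zipWith-0ʳ [] zero _ = refl
  zipWith-0ʳ (x ∷ xs) (suc n) e = cong₂ _∷_ (ℚP.+-identityʳ x) (zipWith-0ʳ xs n (ℕP.suc-injective e))

  zipWith-++ : ∀ (xs ys zs ws : List ℚ) → length xs ≡ length zs →
    zipWith _+_ (xs ++ ys) (zs ++ ws) ≡ zipWith _+_ xs zs ++ zipWith _+_ ys ws
  zipWith-++ [] ys [] ws _ = refl
  zipWith-++ (x ∷ xs) ys (z ∷ zs) ws e = cong (x + z ∷_) (zipWith-++ xs ys zs ws (ℕP.suc-injective e))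

  add-unitWord : ∀ k u → k < length u →
    zipWith _+_ (scaledIndicator 1ℚ (unitWord k (length u))) (map ℕ→ℚ u) ≡ map ℕ→ℚ (incrementAt k u)
  add-unitWord zero (x ∷ u) _ = cong₂ _∷_ (sym (ℕ→ℚ-suc x))
    (trans (cong (λ z → zipWith _+_ z (map ℕ→ℚ u))
                 (trans (LP.map-replicate _ (length u) false) (cong (λ m → replicate m 0ℚ) (sym (LP.length-map ℕ→ℚ u)))))
           (zipWith-0ˡ (map ℕ→ℚ u)))
  add-unitWord (suc k) (x ∷ u) (s≤s k<n) = cong₂ _∷_ (ℚP.+-identityˡ (ℕ→ℚ x)) (add-unitWord k u k<n)

  private
    complement-suc : ∀ t y → y ℕ.≤ t → 1ℚ + ℕ→ℚ (t ∸ y) ≡ ℕ→ℚ (suc t ∸ y)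
    complement-suc t y y≤t = trans (sym (ℕ→ℚ-suc (t ∸ y))) (cong ℕ→ℚ (sym (ℕP.+-∸-assoc 1 y≤t)))

    add-allTrue : ∀ t v → All (ℕ._≤ t) v →
      zipWith _+_ (scaledIndicator 1ℚ (replicate (length v) true)) (map (λ y → ℕ→ℚ (t ∸ y)) v)
        ≡ map (λ y → ℕ→ℚ (suc t ∸ y)) v
    add-allTrue t [] _ = refl
    add-allTrue t (y ∷ v) (y≤t ∷ v≤t) = cong₂ _∷_ (complement-suc t y y≤t) (add-allTrue t v v≤t)

  add-counitWord : ∀ t j v → j < length v → All (ℕ._≤ t) v →
    zipWith _+_ (scaledIndicator 1ℚ (counitWord j (length v))) (map (λ y → ℕ→ℚ (t ∸ y)) v)
      ≡ map (λ y → ℕ→ℚ (suc t ∸ y)) (incrementAt j v)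
  add-counitWord t zero (y ∷ v) _ (_ ∷ v≤t) = cong₂ _∷_ (ℚP.+-identityˡ _) (add-allTrue t v v≤t)
  add-counitWord t (suc j) (y ∷ v) (s≤s j<n) (y≤t ∷ v≤t) =
    cong₂ _∷_ (complement-suc t y y≤t) (add-counitWord t j v j<n v≤t)

  module _ (a' b' : ℕ) where
    open Snake a' b'
    private
      n : ℕ
      n = a ℕ.+ b
      IsB : List Bool → Set
      IsB = IsSnakeBasis a b

    point : ℕ → List ℕ → List ℕ → List ℚ
    point t u v = map ℕ→ℚ u ++ map (λ y → ℕ→ℚ (t ∸ y)) v

    lowerPath-basis : IsB (snakeL a b)
    lowerPath-basis = snakeBasis⇐ (snakeL a b) length-snakeL north-snakeL prefix
      where
      north-snakeL : north (snakeL a b) ≡ b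
      north-snakeL = trans (north-++ (replicate a false) (replicate b true))
                           (cong₂ ℕ._+_ (north-replicate-false a) (north-replicate-true b))
      prefix : northPrefix a (snakeL a b) ℕ.≤ 1
      prefix = ℕP.≤-trans (ℕP.≤-reflexive (northPrefix-snakeL a))
               (ℕP.≤-trans (ℕP.m⊓n≤m (a ∸ a) b) (ℕP.≤-trans (ℕP.≤-reflexive (ℕP.n∸n≡0 a)) z≤n))

    hook : ℕ → ℕ → List Bool
    hook k j = unitWord k a ++ counitWord j b

    hook-basis : ∀ k j → k < a → j < b → IsB (hook k j)
    hook-basis k j k<a j<b = snakeBasis⇐ (hook k j) length-hook north-hook prefix
      where
      length-hook : length (hook k j) ≡ n
      length-hook = trans (LP.length-++ (unitWord k a)) (cong₂ ℕ._+_ (length-unitWord k a) (length-counitWord j b))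
      north-hook : north (hook k j) ≡ b
      north-hook = trans (north-++ (unitWord k a) (counitWord j b))
                         (cong₂ ℕ._+_ (north-unitWord k a k<a) (north-counitWord j b' j<b))
      prefix : northPrefix a (hook k j) ℕ.≤ 1
      prefix = begin
        northPrefix a (hook k j)
          ≡⟨ northPrefix-++ a (unitWord k a) (counitWord j b) ⟩
        northPrefix a (unitWord k a) ℕ.+ northPrefix (a ∸ length (unitWord k a)) (counitWord j b)
          ≡⟨ cong (λ z → northPrefix a (unitWord k a) ℕ.+ northPrefix (a ∸ z) (counitWord j b)) (length-unitWord k a) ⟩
        northPrefix a (unitWord k a) ℕ.+ northPrefix (a ∸ a) (counitWord j b)
          ≡⟨ cong (λ z → northPrefix a (unitWord k a) ℕ.+ northPrefix z (counitWord j b)) (ℕP.n∸n≡0 a) ⟩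
        northPrefix a (unitWord k a) ℕ.+ 0
          ≡⟨ ℕP.+-identityʳ _ ⟩
        northPrefix a (unitWord k a)
          ≤⟨ northPrefix≤north a (unitWord k a) ⟩
        north (unitWord k a)
          ≡⟨ north-unitWord k a k<a ⟩
        1 ∎
        where open ℕP.≤-Reasoning

    -- s = 0: the point (0, …, 0, t, …, t) is t·e_L.
    level-zero-point : ∀ t u v → IsComposition a 0 u → IsComposition b 0 v → InDilate n IsB t (point t u v)
    level-zero-point t u v (length-u , sum-u) (length-v , sum-v) =
      (ℕ→ℚ t , snakeL a b) ∷ [] , (ℕ→ℚ-mono-≤ {0} {t} z≤n , lowerPath-basis) ∷ [] , ℚP.+-identityʳ (ℕ→ℚ t) , combination≡
      where
      open ≡-Reasoning
      combination≡ : combination n ((ℕ→ℚ t , snakeL a b) ∷ []) ≡ point t u v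
      combination≡ = begin
        zipWith _+_ (scaledIndicator (ℕ→ℚ t) (snakeL a b)) (replicate n 0ℚ)
          ≡⟨ zipWith-0ʳ _ n (trans (length-scaledIndicator (ℕ→ℚ t) (snakeL a b)) length-snakeL) ⟩
        scaledIndicator (ℕ→ℚ t) (snakeL a b)
          ≡⟨ LP.map-++ _ (replicate a false) (replicate b true) ⟩
        map _ (replicate a false) ++ map _ (replicate b true)
          ≡⟨ cong₂ _++_ (LP.map-replicate _ a false) (LP.map-replicate _ b true) ⟩
        replicate a 0ℚ ++ replicate b (ℕ→ℚ t)
          ≡⟨ cong₂ _++_ (sym (LP.map-replicate ℕ→ℚ a 0)) (sym (LP.map-replicate (λ y → ℕ→ℚ (t ∸ y)) b 0)) ⟩
        point t (replicate a 0) (replicate b 0)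
          ≡⟨ cong₂ (point t) (sym (trans (sum≡0 u sum-u) (cong (λ m → replicate m 0) length-u)))
                             (sym (trans (sum≡0 v sum-v) (cong (λ m → replicate m 0) length-v))) ⟩
        point t u v ∎

    -- Adding the hook basis (k, j) with weight 1 passes from level s to s+1 and from t to t+1.
    hook-step : ∀ t k j u v → k < length u → j < length v → length u ≡ a → length v ≡ b →
      All (ℕ._≤ t) v → InDilate n IsB t (point t u v) →
      InDilate n IsB (suc t) (point (suc t) (incrementAt k u) (incrementAt j v))
    hook-step t k j u v k<u j<v length-u length-v v≤t (cs , weighted , total , combination≡) =
      (1ℚ , hook k j) ∷ cs ,
      (ℕ→ℚ-mono-≤ {0} {1} z≤n , hook-basis k j (subst (k <_) length-u k<u) (subst (j <_) length-v j<v)) ∷ weighted ,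
      trans (cong (1ℚ +_) total) (sym (ℕ→ℚ-suc t)) ,
      (begin
        zipWith _+_ (scaledIndicator 1ℚ (hook k j)) (combination n cs)
          ≡⟨ cong (zipWith _+_ (scaledIndicator 1ℚ (hook k j))) combination≡ ⟩
        zipWith _+_ (scaledIndicator 1ℚ (hook k j)) (point t u v)
          ≡⟨ cong (λ z → zipWith _+_ z (point t u v)) (LP.map-++ _ (unitWord k a) (counitWord j b)) ⟩
        zipWith _+_ (scaledIndicator 1ℚ (unitWord k a) ++ scaledIndicator 1ℚ (counitWord j b)) (point t u v)
          ≡⟨ zipWith-++ (scaledIndicator 1ℚ (unitWord k a)) _ (map ℕ→ℚ u) _ halves-aligned ⟩
        zipWith _+_ (scaledIndicator 1ℚ (unitWord k a)) (map ℕ→ℚ u)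
          ++ zipWith _+_ (scaledIndicator 1ℚ (counitWord j b)) (map (λ y → ℕ→ℚ (t ∸ y)) v)
          ≡⟨ cong₂ (λ p q → zipWith _+_ (scaledIndicator 1ℚ (unitWord k p)) (map ℕ→ℚ u)
                               ++ zipWith _+_ (scaledIndicator 1ℚ (counitWord j q)) (map (λ y → ℕ→ℚ (t ∸ y)) v))
                   (sym length-u) (sym length-v) ⟩
        zipWith _+_ (scaledIndicator 1ℚ (unitWord k (length u))) (map ℕ→ℚ u)
          ++ zipWith _+_ (scaledIndicator 1ℚ (counitWord j (length v))) (map (λ y → ℕ→ℚ (t ∸ y)) v)
          ≡⟨ cong₂ _++_ (add-unitWord k u k<u) (add-counitWord t j v j<v v≤t) ⟩
        point (suc t) (incrementAt k u) (incrementAt j v) ∎)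
      where
      open ≡-Reasoning
      halves-aligned : length (scaledIndicator 1ℚ (unitWord k a)) ≡ length (map ℕ→ℚ u)
      halves-aligned = trans (length-scaledIndicator 1ℚ (unitWord k a))
                       (trans (length-unitWord k a) (sym (trans (LP.length-map ℕ→ℚ u) length-u)))

    pair-point-in-dilate : ∀ s t u v → s ℕ.≤ t → IsComposition a s u → IsComposition b s v →
      InDilate n IsB t (point t u v)
    pair-point-in-dilate zero t u v _ u-comp v-comp = level-zero-point t u v u-comp v-comp
    pair-point-in-dilate (suc s) (suc t) u v (s≤s s≤t) (length-u , sum-u) (length-v , sum-v)
      with decrement u s sum-u | decrement v s sum-v
    ... | k , u' , k<u' , refl , sum-u' , length-u' | j , v' , j<v' , refl , sum-v' , length-v' =
      hook-step t k j u' v' k<u' j<v' (trans length-u' length-u) (trans length-v' length-v)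
        (All.map (λ y≤s → ℕP.≤-trans y≤s (ℕP.≤-trans (ℕP.≤-reflexive sum-v') s≤t)) (entries≤sum v'))
        (pair-point-in-dilate s t u' v' s≤t (trans length-u' length-u , sum-u') (trans length-v' length-v , sum-v'))

module LatticePoints where
  open import Defs hiding (sum)
  open Casts
  open FiniteSums using (∑)
  open SnakeFormula using (levelCount)
  open LatticePaths using (module Snake)
  open Compositions
  open PolytopeBounds
  open HookDecomposition using (point; pair-point-in-dilate; entries≤sum)
  open import Data.Nat as ℕ using (ℕ; suc; _∸_; _⊓_)
  import Data.Nat.Properties as ℕP
  open import Data.Bool using (Bool)
  open import Data.Integer as ℤ using (ℤ; +_; -[1+_])
  import Data.Integer.Properties as ℤP
  import Data.Rational as ℚ
  open import Data.List as List using (List; []; _∷_; _++_; length; map; take; drop)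
  open import Data.Nat.ListAction using (sum)
  open import Data.Nat.ListAction.Properties using (sum-++)
  import Data.List.Properties as LP
  open import Data.List.Relation.Unary.All as All using (All; []; _∷_)
  import Data.List.Relation.Unary.All.Properties as All
  open import Data.List.Relation.Unary.Unique.Propositional using (Unique)
  open import Data.List.Relation.Unary.AllPairs using ([]; _∷_)
  open import Data.List.Membership.Propositional using (_∈_)
  open import Data.List.Membership.Propositional.Properties using (∈-map⁺)
  open import Data.List.Relation.Unary.Any using (here; there)
  open import Data.Product using (Σ; _×_; _,_; proj₁)
  open import Relation.Binary.PropositionalEquality

  Unique-map : ∀ {A B : Set} (f : A → B) (xs : List A) → Unique xs →
    (∀ {x y} → x ∈ xs → y ∈ xs → f x ≡ f y → x ≡ y) → Unique (map f xs)
  Unique-map f [] _ _ = []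
  Unique-map f (x ∷ xs) (x∉xs ∷ xs!) injective =
    All.map⁺ (All.tabulate (λ y∈xs fx≡fy → All.lookup x∉xs y∈xs (injective (here refl) (there y∈xs) fx≡fy)))
    ∷ Unique-map f xs xs! (λ p q → injective (there p) (there q))

  ++-injective : ∀ {A : Set} (xs ys : List A) {xs' ys'} → length xs ≡ length ys →
    xs ++ xs' ≡ ys ++ ys' → xs ≡ ys × xs' ≡ ys'
  ++-injective [] [] _ e = refl , e
  ++-injective (x ∷ xs) (y ∷ ys) l e with ++-injective xs ys (ℕP.suc-injective l) (LP.∷-injectiveʳ e)
  ... | xs≡ys , xs'≡ys' = cong₂ _∷_ (LP.∷-injectiveˡ e) xs≡ys , xs'≡ys'

  sum-ℕ→ℚ : ∀ w → Defs.sum (map ℕ→ℚ w) ≡ ℕ→ℚ (sum w)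
  sum-ℕ→ℚ [] = refl
  sum-ℕ→ℚ (x ∷ w) = trans (cong (ℕ→ℚ x ℚ.+_) (sum-ℕ→ℚ w)) (sym (ℕ→ℚ-+ x (sum w)))

  sum-complement : ∀ t w → All (ℕ._≤ t) w → sum (map (t ∸_) w) ℕ.+ sum w ≡ length w ℕ.* t
  sum-complement t [] _ = refl
  sum-complement t (y ∷ w) (y≤t ∷ w≤t) = begin
    (t ∸ y) ℕ.+ sum (map (t ∸_) w) ℕ.+ (y ℕ.+ sum w)
      ≡⟨ interchange (t ∸ y) (sum (map (t ∸_) w)) y (sum w) ⟩
    ((t ∸ y) ℕ.+ y) ℕ.+ (sum (map (t ∸_) w) ℕ.+ sum w)
      ≡⟨ cong₂ ℕ._+_ (ℕP.m∸n+n≡m y≤t) (sum-complement t w w≤t) ⟩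
    t ℕ.+ length w ℕ.* t ∎
    where
    open ≡-Reasoning
    open import Data.Nat.Solver using (module +-*-Solver)
    open +-*-Solver
    interchange : ∀ A B C D → A ℕ.+ B ℕ.+ (C ℕ.+ D) ≡ (A ℕ.+ C) ℕ.+ (B ℕ.+ D)
    interchange = solve 4 (λ A B C D → A :+ B :+ (C :+ D) := (A :+ C) :+ (B :+ D)) refl

  complement-injective : ∀ t v v' → All (ℕ._≤ t) v → All (ℕ._≤ t) v' →
    map (λ y → + (t ∸ y)) v ≡ map (λ y → + (t ∸ y)) v' → v ≡ v'
  complement-injective t [] [] _ _ _ = refl
  complement-injective t (y ∷ v) (y' ∷ v') (y≤t ∷ v≤t) (y'≤t ∷ v'≤t) e =
    cong₂ _∷_ (trans (sym (ℕP.m∸[m∸n]≡n y≤t)) (trans (cong (t ∸_) (ℤP.+-injective (LP.∷-injectiveˡ e)))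
                                                      (ℕP.m∸[m∸n]≡n y'≤t)))
              (complement-injective t v v' v≤t v'≤t (LP.∷-injectiveʳ e))

  naturals-between : ∀ t (x : List ℤ) → All (λ z → Between0 (ℕ→ℚ t) (ℤ→ℚ z)) x →
    Σ (List ℕ) λ w → (x ≡ map +_ w) × All (ℕ._≤ t) w
  naturals-between t [] [] = [] , refl , []
  naturals-between t (z ∷ x) ((0≤z , z≤t) ∷ bounds) with naturals-between t x bounds
  ... | w , refl , w≤t with z | ℤ→ℚ-cancel-≤ {+ 0} {z} 0≤z
  ...   | + k | _ = k ∷ w , refl , ℤP.drop‿+≤+ (ℤ→ℚ-cancel-≤ {+ k} {+ t} z≤t) ∷ w≤t
  ...   | -[1+ k ] | ()

  module _ (a' b' : ℕ) where
    open Snake a' b' using (a; b; snakeBasis⇒)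
    open Pairs a b
    private
      n : ℕ
      n = a ℕ.+ b
      IsB : List Bool → Set
      IsB = IsSnakeBasis a b
      length-basis : ∀ {B} → IsB B → length B ≡ n
      length-basis ((length≡ , _) , _) = length≡

    embed : ℕ → List ℕ × List ℕ → List ℤ
    embed t (u , v) = map +_ u ++ map (λ y → + (t ∸ y)) v

    embed-point : ∀ t u v → map ℤ→ℚ (embed t (u , v)) ≡ point a' b' t u v
    embed-point t u v = trans (LP.map-++ ℤ→ℚ (map +_ u) _) (cong₂ _++_ (sym (LP.map-∘ u)) (sym (LP.map-∘ v)))

    latticePoints : ℕ → List (List ℤ)
    latticePoints t = map (embed t) (levelsUpTo t)

    private
      entries≤t : ∀ t {u v} → (u , v) ∈ levelsUpTo t → All (ℕ._≤ t) v
      entries≤t t {v = v} p∈ with levelsUpTo-sound t p∈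
      ... | s , s≤t , _ , (_ , sum-v) =
        All.map (λ y≤s → ℕP.≤-trans y≤s (ℕP.≤-trans (ℕP.≤-reflexive sum-v) s≤t)) (entries≤sum v)

    latticePoints-sound : ∀ t → All (LatticePointOf n IsB t) (latticePoints t)
    latticePoints-sound t = All.map⁺ (All.tabulate point-of)
      where
      point-of : ∀ {p} → p ∈ levelsUpTo t → LatticePointOf n IsB t (embed t p)
      point-of {u , v} p∈ with levelsUpTo-sound t p∈
      ... | s , s≤t , u-comp@(length-u , _) , v-comp@(length-v , _) =
        trans (LP.length-++ (map +_ u)) (cong₂ ℕ._+_ (trans (LP.length-map +_ u) length-u) (trans (LP.length-map _ v) length-v)) ,
        subst (InDilate n IsB t) (sym (embed-point t u v)) (pair-point-in-dilate a' b' s t u v s≤t u-comp v-comp)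

    latticePoints-unique : ∀ t → Unique (latticePoints t)
    latticePoints-unique t = Unique-map (embed t) (levelsUpTo t) (levelsUpTo-unique t) injective
      where
      injective : ∀ {p q} → p ∈ levelsUpTo t → q ∈ levelsUpTo t → embed t p ≡ embed t q → p ≡ q
      injective {u , v} {u' , v'} p∈ q∈ e with levelsUpTo-sound t p∈ | levelsUpTo-sound t q∈
      ... | _ , _ , (length-u , _) , _ | _ , _ , (length-u' , _) , _
        with ++-injective (map +_ u) (map +_ u')
               (trans (LP.length-map +_ u) (trans length-u (sym (trans (LP.length-map +_ u') length-u')))) e
      ...   | u≡u' , v≡v' = cong₂ _,_ (LP.map-injective ℤP.+-injective u≡u')
                                      (complement-injective t v v' (entries≤t t p∈) (entries≤t t q∈) v≡v')

    -- Natural vectors satisfying the inequalities of PolytopeBounds for the snake.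
    Admissible : ℕ → List ℕ → Set
    Admissible t w = All (ℕ._≤ t) w × length w ≡ n × sum w ≡ b ℕ.* t × sum (take a w) ℕ.≤ t

    lattice-point-admissible : ∀ t x → LatticePointOf n IsB t x → Σ (List ℕ) λ w → x ≡ map +_ w × Admissible t w
    lattice-point-admissible t x (length-x , cs , weighted , total , combination≡) =
      admissible (naturals-between t x bounds)
      where
      bounds : All (λ z → Between0 (ℕ→ℚ t) (ℤ→ℚ z)) x
      bounds = All.map⁻ (subst (All (Between0 (ℕ→ℚ t))) combination≡
                          (subst (λ m → All (Between0 m) (combination n cs)) total
                                 (combination-bounds n IsB length-basis cs weighted)))
      admissible : (Σ (List ℕ) λ w → x ≡ map +_ w × All (ℕ._≤ t) w) → Σ (List ℕ) λ w → x ≡ map +_ w × Admissible t w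
      admissible (w , x≡w , w≤t) = w , x≡w , w≤t , length-w , sum-w , prefix-w
        where
        combination≡w : combination n cs ≡ map ℕ→ℚ w
        combination≡w = trans combination≡ (trans (cong (map ℤ→ℚ) x≡w) (sym (LP.map-∘ w)))
        length-w : length w ≡ n
        length-w = trans (sym (LP.length-map +_ w)) (trans (cong length (sym x≡w)) length-x)
        sum-w : sum w ≡ b ℕ.* t
        sum-w = ℕ→ℚ-injective (begin
          ℕ→ℚ (sum w)                         ≡⟨ sym (sum-ℕ→ℚ w) ⟩
          Defs.sum (map ℕ→ℚ w)                 ≡⟨ cong Defs.sum (sym combination≡w) ⟩
          Defs.sum (combination n cs)          ≡⟨ combination-sum n IsB length-basis b (λ ((_ , north≡) , _) → north≡) cs weighted ⟩
          ℕ→ℚ b ℚ.* totalWeight n IsB length-basis cs ≡⟨ cong (ℕ→ℚ b ℚ.*_) total ⟩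
          ℕ→ℚ b ℚ.* ℕ→ℚ t                    ≡⟨ sym (ℕ→ℚ-* b t) ⟩
          ℕ→ℚ (b ℕ.* t) ∎)
          where open ≡-Reasoning
        prefix≡ : Defs.sum (take a (combination n cs)) ≡ ℕ→ℚ (sum (take a w))
        prefix≡ = trans (cong Defs.sum (trans (cong (take a) combination≡w) (LP.take-map a w))) (sum-ℕ→ℚ (take a w))
        prefix-w : sum (take a w) ℕ.≤ t
        prefix-w = ℤP.drop‿+≤+ (ℤ→ℚ-cancel-≤ (subst (ℚ._≤ ℕ→ℚ t) prefix≡
          (subst (Defs.sum (take a (combination n cs)) ℚ.≤_) total
                 (combination-prefix n IsB length-basis a snakeBasis⇒ cs weighted))))

    splitting : ℕ → List ℕ → List ℕ × List ℕ
    splitting t w = take a w , map (t ∸_) (drop a w)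

    admissible-in-levels : ∀ t w → Admissible t w → splitting t w ∈ levelsUpTo t
    admissible-in-levels t w (w≤t , length-w , sum-w , prefix-w) =
      levelsUpTo-complete t (sum u) prefix-w ((length-u , refl) , (length-v , sum-v≡sum-u))
      where
      u : List ℕ
      u = take a w
      rest : List ℕ
      rest = drop a w
      length-u : length u ≡ a
      length-u = trans (LP.length-take a w) (trans (cong (a ⊓_) length-w) (ℕP.m≤n⇒m⊓n≡m (ℕP.m≤m+n a b)))
      length-rest : length rest ≡ b
      length-rest = trans (LP.length-drop a w) (trans (cong (_∸ a) length-w) (ℕP.m+n∸m≡n a b))
      length-v : length (map (t ∸_) rest) ≡ b
      length-v = trans (LP.length-map _ rest) length-rest
      sum-v≡sum-u : sum (map (t ∸_) rest) ≡ sum u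
      sum-v≡sum-u = ℕP.+-cancelʳ-≡ (sum rest) _ _
        (trans (sum-complement t rest (All.drop⁺ a w≤t))
        (trans (cong (ℕ._* t) length-rest)
               (sym (trans (sym (sum-++ u rest)) (trans (cong sum (LP.take++drop≡id a w)) sum-w)))))

    embed-splitting : ∀ t w → All (ℕ._≤ t) w → map +_ w ≡ embed t (splitting t w)
    embed-splitting t w w≤t =
      trans (cong (map +_) (sym (LP.take++drop≡id a w)))
      (trans (LP.map-++ +_ (take a w) (drop a w))
             (cong (map +_ (take a w) ++_)
                   (trans (LP.map-cong-local (All.map (λ y≤t → cong +_ (sym (ℕP.m∸[m∸n]≡n y≤t))) (All.drop⁺ a w≤t)))
                          (LP.map-∘ (drop a w)))))

    latticePoints-complete : ∀ t x → LatticePointOf n IsB t x → x ∈ latticePoints t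
    latticePoints-complete t x x∈ = member (lattice-point-admissible t x x∈)
      where
      member : (Σ (List ℕ) λ w → x ≡ map +_ w × Admissible t w) → x ∈ latticePoints t
      member (w , x≡w , admissible) =
        subst (_∈ latticePoints t) (sym (trans x≡w (embed-splitting t w (proj₁ admissible))))
              (∈-map⁺ (embed t) (admissible-in-levels t w admissible))

    latticePoints-ehrhart : ∀ t → EhrhartValue n IsB t (length (latticePoints t))
    latticePoints-ehrhart t =
      latticePoints t , refl , latticePoints-unique t , latticePoints-sound t , latticePoints-complete t

    length-latticePoints : ∀ t → ℕ→ℚ (length (latticePoints t)) ≡ ∑ (suc t) (levelCount a' b')
    length-latticePoints t =
      trans (cong ℕ→ℚ (LP.length-map (embed t) (levelsUpTo t))) (length-levelsUpTo a' b' t)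

open import Defs
open import Data.Nat using (ℕ; _≤_; _+_; suc)
open import Data.Product using (Σ; _×_; _,_)
open import Relation.Binary.PropositionalEquality using (_≡_; trans; sym)
open import Data.List using (length)
open SnakeFormula using (snake-formula-as-sum)
open LatticePoints using (latticePoints; latticePoints-ehrhart; length-latticePoints)

theorem3p8 : (a b : ℕ) → 2 ≤ a → 2 ≤ b → (t : ℕ) →
    Σ ℕ (λ N → EhrhartValue (a + b) (IsSnakeBasis a b) t N × (ℕ→ℚ N ≡ snakeEhrhartFormula a b t))
theorem3p8 (suc a') (suc b') _ _ t =
  length (latticePoints a' b' t) ,
  latticePoints-ehrhart a' b' t ,
  trans (length-latticePoints a' b' t) (sym (snake-formula-as-sum a' b' t))
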